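{- Let $k\ge1$, $a$ an odd integer, and $A=A_{2^k,a}$. If $k=1$ then $G(A,\mathrm{O}(A))=0$. If $k>1$ then $G(A,\mathrm{O}(A))=\left(\frac{2}{a}\right)^k\sqrt{|A|}$.
   Context: A finite quadratic form is a finite abelian group $A$ with $q:A\to\mathbb{Q}/\mathbb{Z}$ such that $q(nx)=n^2q(x)$ and $(x,y):=q(x+y)-q(x)-q(y)$ is a nondegenerate symmetric bilinear form. $\mathrm{O}(A)$ is its isometry group, $e(z)=\exp(2\pi iz)$, and $G(A,\Gamma)=\sum_{[x]\in\Gamma\backslash A}\sum_{y\in\Gamma x}e((x,y))$. $A_{2^k,a}$ is $\mathbb{Z}/2^k$ with $q(x)=ax^2/2^{k+1}\bmod\mathbb{Z}$ (so $(x,y)=axy/2^k$ and the norm $(x,x)=2q(x)=ax^2/2^k\in\mathbb{Q}/2\mathbb{Z}$). $\left(\frac{2}{a}\right)$ is the Jacobi (Kronecker) symbol. -}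

module Defs where

open import Data.Bool using (Bool; true; false; _∧_; _∨_; if_then_else_; not)
open import Data.Nat as ℕ using (ℕ; zero; suc; _∸_; _≡ᵇ_; _<ᵇ_; _≤ᵇ_; NonZero)
open import Data.Nat.Properties using (m^n≢0)
open import Data.Nat.DivMod using (_%_; _/_)
open import Data.Integer as ℤ using (ℤ; +_)
open import Data.Integer.DivMod using (_%ℕ_)
open import Data.Fin using (Fin; toℕ)
open import Data.Vec using (Vec; []; _∷_; lookup)
open import Relation.Binary.PropositionalEquality using (_≡_)
open import Data.List as List using (List; []; _∷_; concatMap; allFin; map; foldr)
open import Data.Bool.ListAction using (all; any)

pow2 : ℕ → ℕ
pow2 m = 2 ℕ.^ m

pow2-nonZero : ∀ m → NonZero (pow2 m)
pow2-nonZero m = m^n≢0 2 m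

_mod2^_ : ℕ → ℕ → ℕ
n mod2^ m = _%_ n (pow2 m) {{pow2-nonZero m}}

_modℤ2^_ : ℤ → ℕ → ℕ
z modℤ2^ m = _%ℕ_ z (pow2 m) {{pow2-nonZero m}}

A : ℕ → Set
A k = Fin (pow2 k)

addA : (k : ℕ) → ℕ → ℕ → ℕ
addA k x y = (x ℕ.+ y) mod2^ k

-- q(x) = a x^2 / 2^(k+1) mod ℤ, represented by the residue a x^2 mod 2^(k+1)
qA : (k : ℕ) → ℤ → A k → ℕ
qA k a x = (a ℤ.* (+ (toℕ x ℕ.* toℕ x))) modℤ2^ (suc k)

-- (x,y) = a x y / 2^k mod ℤ, represented by the residue a x y mod 2^k
bA : (k : ℕ) → ℤ → A k → A k → ℕ
bA k a x y = (a ℤ.* (+ (toℕ x ℕ.* toℕ y))) modℤ2^ k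

allVecs : (m len : ℕ) → List (Vec (Fin m) len)
allVecs m zero = [] ∷ []
allVecs m (suc l) = concatMap (λ i → map (i ∷_) (allVecs m l)) (allFin m)

allA : (k : ℕ) → List (A k)
allA k = allFin (pow2 k)

Map : ℕ → Set
Map k = Vec (A k) (pow2 k)

app : ∀ {k} → Map k → A k → A k
app {k} σ x = lookup σ x

plusA : (k : ℕ) → A k → A k → A k
plusA k x y = Data.Fin.fromℕ< (Data.Nat.DivMod.m%n<n (toℕ x ℕ.+ toℕ y) (pow2 k) {{pow2-nonZero k}})

isHom : (k : ℕ) → Map k → Bool
isHom k σ = all (λ x → all (λ y →
  toℕ (app {k} σ (plusA k x y)) ≡ᵇ
    addA k (toℕ (app {k} σ x)) (toℕ (app {k} σ y))) (allA k)) (allA k)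

isBij : (k : ℕ) → Map k → Bool
isBij k σ =
  all (λ x → all (λ y → not (toℕ (app {k} σ x) ≡ᵇ toℕ (app {k} σ y)) ∨ (toℕ x ≡ᵇ toℕ y)) (allA k)) (allA k)
  ∧ all (λ y → any (λ x → toℕ (app {k} σ x) ≡ᵇ toℕ y) (allA k)) (allA k)

preservesQ : (k : ℕ) → ℤ → Map k → Bool
preservesQ k a σ = all (λ x → qA k a (app {k} σ x) ≡ᵇ qA k a x) (allA k)

isIsometry : (k : ℕ) → ℤ → Map k → Bool
isIsometry k a σ = isHom k σ ∧ isBij k σ ∧ preservesQ k a σ

bfilter : {X : Set} → (X → Bool) → List X → List X
bfilter p [] = []
bfilter p (x ∷ xs) = if p x then x ∷ bfilter p xs else bfilter p xs

OA : (k : ℕ) → ℤ → List (Map k)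
OA k a = bfilter (isIsometry k a) (allVecs (pow2 k) (pow2 k))

inOrbit : (k : ℕ) → ℤ → A k → A k → Bool
inOrbit k a x y = any (λ σ → toℕ (app {k} σ x) ≡ᵇ toℕ y) (OA k a)

-- chosen representative of each orbit: its least element (as a natural number)
isRep : (k : ℕ) → ℤ → A k → Bool
isRep k a x = all (λ y → not (inOrbit k a x y) ∨ (toℕ x ≤ᵇ toℕ y)) (allA k)

-- Values: the cyclotomic ring ℤ[ζ], ζ = e(1/2^k), realised as
-- ℤ[X]/(X^(2^(k-1)) + 1) (for k ≥ 1), elements = coefficient functions
-- on the basis 1, ζ, …, ζ^(2^(k-1)-1).  This is a subring of ℂ via ζ ↦ e(1/2^k).

Cyc : ℕ → Set
Cyc k = Fin (pow2 (k ∸ 1)) → ℤ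

zeroC : ∀ {k} → Cyc k
zeroC _ = + 0

addC : (k : ℕ) → Cyc k → Cyc k → Cyc k
addC k u v i = u i ℤ.+ v i

scale : ∀ {k} → ℤ → Cyc k → Cyc k
scale c u i = c ℤ.* u i

sumC : ∀ {k} {X : Set} → (X → Cyc k) → List X → Cyc k
sumC {k} f = foldr (λ x acc → addC k (f x) acc) (zeroC {k})

-- ζ^j = e(j / 2^k)
root : (k : ℕ) → ℕ → Cyc k
root k j i =
  let r = j mod2^ k
      h = pow2 (k ∸ 1)
  in if r <ᵇ h
       then (if toℕ i ≡ᵇ r then + 1 else + 0)
       else (if toℕ i ≡ᵇ (r ∸ h) then ℤ.- (+ 1) else + 0)

eA : (k : ℕ) → ℤ → A k → A k → Cyc k
eA k a x y = root k (bA k a x y)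

G : (k : ℕ) → ℤ → Cyc k
G k a = sumC {k} (λ x → sumC {k} (λ y → eA k a x y) (bfilter (inOrbit k a x) (allA k)))
             (bfilter (isRep k a) (allA k))

-- √|A| = √(2^k) = 2^(k/2) as an element of ℤ[ζ]:
--   k even:            2^(k/2)
--   k odd (k ≥ 3):     2^((k-1)/2) · √2, with √2 = ζ8 + ζ8⁻¹, ζ8 = ζ^(2^(k-3))
sqrtA : (k : ℕ) → Cyc k
sqrtA k with k % 2
... | 0 = scale {k} (+ (2 ℕ.^ (k / 2))) (root k 0)
... | _ = scale {k} (+ (2 ℕ.^ ((k ∸ 1) / 2)))
                (addC k (root k (pow2 (k ∸ 3))) (root k (pow2 k ∸ pow2 (k ∸ 3))))

-- Jacobi (Kronecker) symbol (2/a) for odd a, via the second supplementary law: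
-- (2/a) = 1 if a ≡ ±1 (mod 8), −1 if a ≡ ±3 (mod 8).
jacobi2 : ℤ → ℤ
jacobi2 a with a %ℕ 8
... | 1 = + 1
... | 7 = + 1
... | _ = ℤ.- (+ 1)

Odd : ℤ → Set
Odd a = a %ℕ 2 ≡ 1

-- An isometry of A = ℤ/2^k is multiplication by some u with a u² ≡ a mod 2^(k+1), i.e.
-- u ≡ ±1 mod 2^k, so the O(A)-orbits are {x, -x} and 2 G(A, O(A)) = S(a) + S(-a) for the
-- quadratic Gauss sum S(c) = Σ_{x mod 2^k} e(c x² / 2^k).  As e(1/2) = -1, the odd x cancel in
-- S, and S over 2^k is twice S over 2^(k-2); this descends to S₄(c) = 2 + 2 e(c/4) and
-- S₈(c) = 4 e(c/8).  For even k the terms e(±a/4) cancel; for odd k what remains is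
-- e(a/8) + e(-a/8) = (2/a) √2, the second supplementary law; for k = 1 everything cancels.

module Submission where

open import Defs
open import Data.Bool using (Bool; true; false; T; not; _∧_; _∨_; if_then_else_)
open import Data.Bool.ListAction using (all; any)
open import Data.Bool.Properties using (T-≡; T-∧; T-∨; ¬-not)
open import Data.Fin using (Fin; toℕ; fromℕ<)
import Data.Fin as Fin
import Data.Fin.Properties as Fin
open import Data.Integer using (ℤ; +_; -[1+_]; _+_; _*_; -_; _-_; _⊖_; ∣_∣; _^_)
open import Data.Integer.DivMod using (_%ℕ_; _/ℕ_; a≡a%ℕn+[a/ℕn]*n; n%ℕd<d)
import Data.Integer.Properties as ℤ
open import Data.Integer.Tactic.RingSolver using (solve-∀)
open import Data.List using ([]; _∷_; map)
open import Data.List.Membership.Propositional using (_∈_; lose; find)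
open import Data.List.Membership.Propositional.Properties using (∈-concatMap⁺; ∈-map⁺; ∈-allFin)
open import Data.List.Relation.Unary.Any using (here; there)
import Data.List.Relation.Unary.All as All
open import Data.List.Relation.Unary.All.Properties using (all⁺; all⁻)
open import Data.List.Relation.Unary.Any.Properties using (any⁺; any⁻)
open import Data.Nat using (ℕ; zero; suc; _≤_; _<_; z≤n; s≤s; NonZero)
import Data.Nat as ℕ
import Data.Nat.Properties as ℕ
open import Data.Nat.Divisibility
  using (_∣_; divides; 1∣_; ∣1⇒≡1; ∣m+n∣m⇒∣n; ∣-trans; m∣m*n; *-monoʳ-∣; *-cancelˡ-∣; ∣⇒≤; >⇒∤)
open import Data.Nat.DivMod
  using (_%_; _/_; m≡m%n+[m/n]*n; m<n⇒m%n≡m; m%n<n; m%n%n≡m%n; n%n≡0; %-distribˡ-+; %-distribˡ-*;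
         [m+kn]%n≡m%n; m*n%n≡0; m*n/n≡m)
open import Data.Nat.Tactic.RingSolver using () renaming (solve-∀ to ℕ-solve-∀)
open import Data.Product using (_×_; _,_; proj₁; proj₂; ∃-syntax)
open import Data.Sum using (_⊎_; inj₁; inj₂)
import Data.Sum as Sum
open import Data.Unit using (tt)
open import Data.Vec using (Vec; []; _∷_; tabulate)
open import Data.Vec.Properties using (lookup∘tabulate)
open import Function using (_∘_; id)
open import Function.Bundles using (Equivalence)
open import Relation.Binary.PropositionalEquality
open import Relation.Nullary using (¬_; contradiction; yes; no)
open import Algebra.Properties.CommutativeSemigroup ℤ.+-commutativeSemigroup using (interchange)
open ≡-Reasoning

∑< : ℕ → (ℕ → ℤ) → ℤ
∑< zero    f = + 0
∑< (suc n) f = f 0 + ∑< n (f ∘ suc)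

syntax ∑< n (λ x → e) = ∑[ x < n ] e

∑-cong : ∀ n {f g : ℕ → ℤ} → (∀ x → x < n → f x ≡ g x) → ∑< n f ≡ ∑< n g
∑-cong zero    eq = refl
∑-cong (suc n) eq = cong₂ _+_ (eq 0 (s≤s z≤n)) (∑-cong n (λ x x<n → eq (suc x) (s≤s x<n)))

∑-vanishing : ∀ n {f : ℕ → ℤ} → (∀ x → x < n → f x ≡ + 0) → ∑< n f ≡ + 0
∑-vanishing zero    eq = refl
∑-vanishing (suc n) eq = cong₂ _+_ (eq 0 (s≤s z≤n)) (∑-vanishing n (λ x x<n → eq (suc x) (s≤s x<n)))

∑-split : ∀ m n (f : ℕ → ℤ) → ∑< (m ℕ.+ n) f ≡ ∑< m f + ∑[ x < n ] f (m ℕ.+ x)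
∑-split zero    n f = sym (ℤ.+-identityˡ _)
∑-split (suc m) n f = trans (cong (λ s → f 0 + s) (∑-split m n (f ∘ suc))) (sym (ℤ.+-assoc (f 0) _ _))

∑-distrib-+ : ∀ n (f g : ℕ → ℤ) → ∑[ x < n ] (f x + g x) ≡ ∑< n f + ∑< n g
∑-distrib-+ zero    f g = refl
∑-distrib-+ (suc n) f g = trans (cong (λ s → f 0 + g 0 + s) (∑-distrib-+ n (f ∘ suc) (g ∘ suc)))
                                (interchange (f 0) (g 0) _ _)

∑-neg : ∀ n (f : ℕ → ℤ) → ∑[ x < n ] (- f x) ≡ - ∑< n f
∑-neg zero    f = refl
∑-neg (suc n) f = trans (cong (λ s → - f 0 + s) (∑-neg n (f ∘ suc))) (sym (ℤ.neg-distrib-+ (f 0) _))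

∑-last : ∀ n (f : ℕ → ℤ) → ∑< (suc n) f ≡ ∑< n f + f n
∑-last zero    f = ℤ.+-comm (f 0) (+ 0)
∑-last (suc n) f = trans (cong (λ s → f 0 + s) (∑-last n (f ∘ suc))) (sym (ℤ.+-assoc (f 0) _ _))

∑-reverse : ∀ n (f : ℕ → ℤ) → ∑[ x < n ] f (n ℕ.∸ suc x) ≡ ∑< n f
∑-reverse zero    f = refl
∑-reverse (suc n) f =
  trans (cong (λ s → f n + s) (∑-reverse n f)) (trans (ℤ.+-comm (f n) _) (sym (∑-last n f)))

∑-even-odd : ∀ n (f : ℕ → ℤ) →
  ∑< (n ℕ.+ n) f ≡ ∑[ x < n ] f (x ℕ.+ x) + ∑[ x < n ] f (suc (x ℕ.+ x))
∑-even-odd zero    f = refl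
∑-even-odd (suc n) f = begin
  f 0 + ∑< (n ℕ.+ suc n) (f ∘ suc)
    ≡⟨ cong (λ m → f 0 + ∑< m (f ∘ suc)) (ℕ.+-suc n n) ⟩
  f 0 + (f 1 + ∑< (n ℕ.+ n) (f ∘ suc ∘ suc))
    ≡⟨ cong (λ s → f 0 + (f 1 + s)) (∑-even-odd n (f ∘ suc ∘ suc)) ⟩
  f 0 + (f 1 + (E + O))
    ≡⟨ cong₂ (λ e o → f 0 + (f 1 + (e + o)))
         (∑-cong n (λ x _ → cong (f ∘ suc) (sym (ℕ.+-suc x x))))
         (∑-cong n (λ x _ → cong (f ∘ suc ∘ suc) (sym (ℕ.+-suc x x)))) ⟩
  f 0 + (f 1 + (E′ + O′))
    ≡⟨ sym (ℤ.+-assoc (f 0) (f 1) _) ⟩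
  (f 0 + f 1) + (E′ + O′)
    ≡⟨ interchange (f 0) (f 1) E′ O′ ⟩
  (f 0 + E′) + (f 1 + O′) ∎
  where
  E  = ∑[ x < n ] f (suc (suc (x ℕ.+ x)))
  O  = ∑[ x < n ] f (suc (suc (suc (x ℕ.+ x))))
  E′ = ∑[ x < n ] f (suc x ℕ.+ suc x)
  O′ = ∑[ x < n ] f (suc (suc x ℕ.+ suc x))

∑-indicator : ∀ n t (g : ℕ → ℤ) → t < n → ∑[ y < n ] (if y ℕ.≡ᵇ t then g y else + 0) ≡ g t
∑-indicator (suc n) zero    g _ =
  trans (cong (λ s → g 0 + s) (∑-vanishing n (λ _ _ → refl))) (ℤ.+-identityʳ (g 0))
∑-indicator (suc n) (suc t) g (s≤s t<n) = trans (ℤ.+-identityˡ _) (∑-indicator n t (g ∘ suc) t<n)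

∑-antiperiodic : ∀ n (f : ℕ → ℤ) → (∀ x → f (n ℕ.+ x) ≡ - f x) → ∑< (n ℕ.+ n) f ≡ + 0
∑-antiperiodic n f anti = begin
  ∑< (n ℕ.+ n) f                          ≡⟨ ∑-split n n f ⟩
  ∑< n f + ∑[ x < n ] f (n ℕ.+ x)          ≡⟨ cong (λ s → ∑< n f + s) (∑-cong n (λ x _ → anti x)) ⟩
  ∑< n f + ∑[ x < n ] (- f x)              ≡⟨ cong (λ s → ∑< n f + s) (∑-neg n f) ⟩
  ∑< n f - ∑< n f                          ≡⟨ ℤ.+-inverseʳ (∑< n f) ⟩
  + 0                                      ∎

∑-periodic : ∀ n (f : ℕ → ℤ) → (∀ x → f (n ℕ.+ x) ≡ f x) → ∑< (n ℕ.+ n) f ≡ ∑< n f + ∑< n f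
∑-periodic n f per = trans (∑-split n n f) (cong (λ s → ∑< n f + s) (∑-cong n (λ x _ → per x)))

%ℕ-unique : ∀ N .{{_ : NonZero N}} {z r} q → r < N → z ≡ + r + q * + N → z %ℕ N ≡ r
%ℕ-unique N {z} {r} q r<N z≡ = ℤ.+-injective (ℤ.i-j≡0⇒i≡j _ _ d≡0)
  where
  r₀ = z %ℕ N
  q₀ = z /ℕ N
  rearrange : ∀ r₀ q₀ r q N → r₀ + q₀ * N ≡ r + q * N → r₀ - r ≡ (q - q₀) * N
  rearrange r₀ q₀ r q N eq = begin
    r₀ - r                      ≡⟨ add-sub r₀ q₀ r N ⟩
    (r₀ + q₀ * N) - q₀ * N - r  ≡⟨ cong (λ u → u - q₀ * N - r) eq ⟩
    (r + q * N) - q₀ * N - r    ≡⟨ collect r q q₀ N ⟩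
    (q - q₀) * N                ∎
    where
    add-sub : ∀ r₀ q₀ r N → r₀ - r ≡ (r₀ + q₀ * N) - q₀ * N - r
    add-sub = solve-∀
    collect : ∀ r q q₀ N → (r + q * N) - q₀ * N - r ≡ (q - q₀) * N
    collect = solve-∀
  d≡ : + r₀ - + r ≡ (q - q₀) * + N
  d≡ = rearrange (+ r₀) q₀ (+ r) q (+ N) (trans (sym (a≡a%ℕn+[a/ℕn]*n z N)) z≡)
  -- r₀ - r is a multiple of N, but smaller than N in absolute value.
  ∣d∣<N : ∣ q - q₀ ∣ ℕ.* N < N
  ∣d∣<N = subst (_< N) (trans (cong ∣_∣ (trans (sym (ℤ.[+m]-[+n]≡m⊖n r₀ r)) d≡)) (ℤ.abs-* (q - q₀) (+ N)))
                (ℕ.≤-<-trans (ℤ.∣m⊝n∣≤m⊔n r₀ r) (ℕ.⊔-lub (n%ℕd<d z N) r<N))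
  ∣q-q₀∣≡0 : ∣ q - q₀ ∣ ≡ 0
  ∣q-q₀∣≡0 = ℕ.n<1⇒n≡0 (ℕ.*-cancelʳ-< N ∣ q - q₀ ∣ 1 (subst (∣ q - q₀ ∣ ℕ.* N <_) (sym (ℕ.*-identityˡ N)) ∣d∣<N))
  d≡0 : + r₀ - + r ≡ + 0
  d≡0 = trans d≡ (trans (cong (_* + N) (ℤ.∣i∣≡0⇒i≡0 {q - q₀} ∣q-q₀∣≡0)) (ℤ.*-zeroˡ (+ N)))

%ℕ-periodic : ∀ N .{{_ : NonZero N}} z t → (z + t * + N) %ℕ N ≡ z %ℕ N
%ℕ-periodic N z t = %ℕ-unique N (z /ℕ N + t) (n%ℕd<d z N)
  (trans (cong (_+ t * + N) (a≡a%ℕn+[a/ℕn]*n z N)) (regroup (+ (z %ℕ N)) (z /ℕ N) t (+ N)))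
  where
  regroup : ∀ r q t N → r + q * N + t * N ≡ r + (q + t) * N
  regroup = solve-∀

%ℕ-≡⇒∣- : ∀ N .{{_ : NonZero N}} z w → z %ℕ N ≡ w %ℕ N → N ∣ ∣ z - w ∣
%ℕ-≡⇒∣- N z w eq = divides ∣ z /ℕ N - w /ℕ N ∣ (trans (cong ∣_∣ z-w≡) (ℤ.abs-* (z /ℕ N - w /ℕ N) (+ N)))
  where
  cancel : ∀ r p q N → (r + p * N) - (r + q * N) ≡ (p - q) * N
  cancel = solve-∀
  z-w≡ : z - w ≡ (z /ℕ N - w /ℕ N) * + N
  z-w≡ = begin
    z - w
      ≡⟨ cong₂ _-_ (a≡a%ℕn+[a/ℕn]*n z N) (a≡a%ℕn+[a/ℕn]*n w N) ⟩
    (+ (z %ℕ N) + z /ℕ N * + N) - (+ (w %ℕ N) + w /ℕ N * + N)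
      ≡⟨ cong (λ r → (+ (z %ℕ N) + z /ℕ N * + N) - (+ r + w /ℕ N * + N)) (sym eq) ⟩
    (+ (z %ℕ N) + z /ℕ N * + N) - (+ (z %ℕ N) + w /ℕ N * + N)
      ≡⟨ cancel (+ (z %ℕ N)) (z /ℕ N) (w /ℕ N) (+ N) ⟩
    (z /ℕ N - w /ℕ N) * + N ∎

∣∧<⇒≡0 : ∀ {d} m → d ∣ m → m < d → m ≡ 0
∣∧<⇒≡0 zero    _   _   = refl
∣∧<⇒≡0 (suc m) d∣m m<d = contradiction d∣m (>⇒∤ m<d)

[m%d*n]%d≡[m*n]%d : ∀ m n d .{{_ : NonZero d}} → ((m % d) ℕ.* n) % d ≡ (m ℕ.* n) % d
[m%d*n]%d≡[m*n]%d m n d = begin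
  ((m % d) ℕ.* n) % d              ≡⟨ %-distribˡ-* (m % d) n d ⟩
  ((m % d % d) ℕ.* (n % d)) % d    ≡⟨ cong (λ x → (x ℕ.* (n % d)) % d) (m%n%n≡m%n m d) ⟩
  ((m % d) ℕ.* (n % d)) % d        ≡⟨ %-distribˡ-* m n d ⟨
  (m ℕ.* n) % d                    ∎

[m%d+n]%d≡[m+n]%d : ∀ m n d .{{_ : NonZero d}} → ((m % d) ℕ.+ n) % d ≡ (m ℕ.+ n) % d
[m%d+n]%d≡[m+n]%d m n d = begin
  ((m % d) ℕ.+ n) % d              ≡⟨ %-distribˡ-+ (m % d) n d ⟩
  ((m % d % d) ℕ.+ (n % d)) % d    ≡⟨ cong (λ x → (x ℕ.+ (n % d)) % d) (m%n%n≡m%n m d) ⟩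
  ((m % d) ℕ.+ (n % d)) % d        ≡⟨ %-distribˡ-+ m n d ⟨
  (m ℕ.+ n) % d                    ∎

[s+s]%d≡s⇒s≡0 : ∀ s d .{{_ : NonZero d}} → s < d → (s ℕ.+ s) % d ≡ s → s ≡ 0
[s+s]%d≡s⇒s≡0 s d s<d eq = ∣∧<⇒≡0 s (divides ((s ℕ.+ s) / d) (ℕ.+-cancelˡ-≡ s _ _ s+s≡)) s<d
  where
  s+s≡ : s ℕ.+ s ≡ s ℕ.+ (s ℕ.+ s) / d ℕ.* d
  s+s≡ = trans (m≡m%n+[m/n]*n (s ℕ.+ s) d) (cong (ℕ._+ (s ℕ.+ s) / d ℕ.* d) eq)

pos-*+ : ∀ m n x → + (m ℕ.* n ℕ.+ x) ≡ + m * + n + + x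
pos-*+ m n x = trans (ℤ.pos-+ (m ℕ.* n) x) (cong (_+ + x) (ℤ.pos-* m n))

pos-odd : ∀ x → + suc (x ℕ.+ x) ≡ + 1 + (+ x + + x)
pos-odd x = trans (ℤ.pos-+ 1 (x ℕ.+ x)) (cong (λ u → + 1 + u) (ℤ.pos-+ x x))

-- Quadratic Gauss sums of an antiperiodic function

-- Only χ (z + h) = - χ z is used (for the coordinates of ζ^z this is ζ^h = -1).
module GaussSums {h : ℕ} (χ : ℤ → ℤ) (χ-anti : ∀ z → χ (z + + h) ≡ - χ z) where

  χ-periodic : ∀ z n → χ (z + + n * (+ h + + h)) ≡ χ z
  χ-periodic z zero    = cong χ (trans (cong (λ u → z + u) (ℤ.*-zeroˡ (+ h + + h))) (ℤ.+-identityʳ z))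
  χ-periodic z (suc n) = begin
    χ (z + + suc n * (+ h + + h))       ≡⟨ cong χ (shift z (+ n) (+ h)) ⟩
    χ (z + + n * (+ h + + h) + + h + + h) ≡⟨ χ-anti _ ⟩
    - χ (z + + n * (+ h + + h) + + h)     ≡⟨ cong -_ (χ-anti _) ⟩
    - - χ (z + + n * (+ h + + h))         ≡⟨ ℤ.neg-involutive _ ⟩
    χ (z + + n * (+ h + + h))             ≡⟨ χ-periodic z n ⟩
    χ z                                   ∎
    where
    shift : ∀ z n h → z + (+ 1 + n) * (h + h) ≡ z + n * (h + h) + h + h
    shift = solve-∀

  χ-mod : ∀ {H} → + h ≡ H → ∀ t {z w} → z ≡ w + t * (H + H) → χ z ≡ χ w
  χ-mod refl (+ n)      {z} {w} eq = trans (cong χ eq) (χ-periodic w n)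
  χ-mod refl -[1+ n ]   {z} {w} eq = sym (trans (cong χ w≡) (χ-periodic z (suc n)))
    where
    w≡ : w ≡ z + + suc n * (+ h + + h)
    w≡ = trans (unshift w (+ suc n) (+ h + + h)) (cong (_+ + suc n * (+ h + + h)) (sym eq))
      where
      unshift : ∀ w t p → w ≡ w + (- t) * p + t * p
      unshift = solve-∀

  χ-half : ∀ {H} → + h ≡ H → ∀ t {z w} → z ≡ w + H + t * (H + H) → χ z ≡ - χ w
  χ-half refl t eq = trans (χ-mod refl t eq) (χ-anti _)

  gauss : ℕ → ℤ → ℤ
  gauss N w = ∑[ x < N ] χ (w * (+ x * + x))

  gauss-4 : ∀ c Q → + h ≡ + 2 * Q → gauss 4 (c * Q) ≡ + 2 * χ (+ 0) + + 2 * χ (c * Q)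
  gauss-4 c Q hQ = collect
    (cong χ (ℤ.*-zeroʳ (c * Q)))
    (cong χ (ℤ.*-identityʳ (c * Q)))
    (χ-mod hQ c (x4 c Q))
    (χ-mod hQ (+ 2 * c) (x9 c Q))
    where
    x4 : ∀ c Q → c * Q * + 4 ≡ + 0 + c * (+ 2 * Q + + 2 * Q)
    x4 = solve-∀
    x9 : ∀ c Q → c * Q * + 9 ≡ c * Q + + 2 * c * (+ 2 * Q + + 2 * Q)
    x9 = solve-∀
    collect : ∀ {t₀ t₁ t₂ t₃ a b} → t₀ ≡ a → t₁ ≡ b → t₂ ≡ a → t₃ ≡ b →
              t₀ + (t₁ + (t₂ + (t₃ + + 0))) ≡ + 2 * a + + 2 * b
    collect {a = a} {b} refl refl refl refl = sum₄ a b
      where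
      sum₄ : ∀ a b → a + (b + (a + (b + + 0))) ≡ + 2 * a + + 2 * b
      sum₄ = solve-∀

  -- The squares 0, 1, 4, …, 49 are 0, 1, 4, 1, 0, 1, 4, 1 modulo 8, and 4Q is the half-period.
  gauss-8 : ∀ {c} s → c ≡ + 1 + + 2 * s → ∀ Q → + h ≡ + 4 * Q → gauss 8 (c * Q) ≡ + 4 * χ (c * Q)
  gauss-8 s refl Q hQ = collect
    (cong χ (ℤ.*-zeroʳ (c * Q)))
    (cong χ (ℤ.*-identityʳ (c * Q)))
    (χ-half hQ s (x4 s Q))
    (χ-mod hQ c (x9 s Q))
    (χ-mod hQ (+ 2 * c) (x16 s Q))
    (χ-mod hQ (+ 3 * c) (x25 s Q))
    (χ-half hQ (s + + 4 * c) (x36 s Q))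
    (χ-mod hQ (+ 6 * c) (x49 s Q))
    where
    c = + 1 + + 2 * s
    x4 : ∀ s Q → (+ 1 + + 2 * s) * Q * + 4 ≡ + 0 + + 4 * Q + s * (+ 4 * Q + + 4 * Q)
    x4 = solve-∀
    x9 : ∀ s Q → (+ 1 + + 2 * s) * Q * + 9 ≡ (+ 1 + + 2 * s) * Q + (+ 1 + + 2 * s) * (+ 4 * Q + + 4 * Q)
    x9 = solve-∀
    x16 : ∀ s Q → (+ 1 + + 2 * s) * Q * + 16 ≡ + 0 + + 2 * (+ 1 + + 2 * s) * (+ 4 * Q + + 4 * Q)
    x16 = solve-∀
    x25 : ∀ s Q → (+ 1 + + 2 * s) * Q * + 25 ≡ (+ 1 + + 2 * s) * Q + + 3 * (+ 1 + + 2 * s) * (+ 4 * Q + + 4 * Q)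
    x25 = solve-∀
    x36 : ∀ s Q → (+ 1 + + 2 * s) * Q * + 36 ≡ + 0 + + 4 * Q + (s + + 4 * (+ 1 + + 2 * s)) * (+ 4 * Q + + 4 * Q)
    x36 = solve-∀
    x49 : ∀ s Q → (+ 1 + + 2 * s) * Q * + 49 ≡ (+ 1 + + 2 * s) * Q + + 6 * (+ 1 + + 2 * s) * (+ 4 * Q + + 4 * Q)
    x49 = solve-∀
    collect : ∀ {t₀ t₁ t₂ t₃ t₄ t₅ t₆ t₇ a b} →
              t₀ ≡ a → t₁ ≡ b → t₂ ≡ - a → t₃ ≡ b → t₄ ≡ a → t₅ ≡ b → t₆ ≡ - a → t₇ ≡ b →
              t₀ + (t₁ + (t₂ + (t₃ + (t₄ + (t₅ + (t₆ + (t₇ + + 0))))))) ≡ + 4 * b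
    collect {a = a} {b} refl refl refl refl refl refl refl refl = sum₈ a b
      where
      sum₈ : ∀ a b → a + (b + (- a + (b + (a + (b + (- a + (b + + 0))))))) ≡ + 4 * b
      sum₈ = solve-∀

  -- For odd x = 2y + 1, shifting y by 2n changes c P x² by an odd multiple of h, so these terms
  -- cancel; the even x = 2y give the sum of length 4n at 4 c P, twice over.
  gauss-descent : ∀ {c} s → c ≡ + 1 + + 2 * s → ∀ P n → + h ≡ + 8 * P * + n →
                  gauss (16 ℕ.* n) (c * P) ≡ + 2 * gauss (4 ℕ.* n) (c * (+ 4 * P))
  gauss-descent s refl P n hP = begin
    ∑< (16 ℕ.* n) f
      ≡⟨ cong (λ N → ∑< N f) (ℕ.*-distribʳ-+ n 8 8) ⟩
    ∑< (8 ℕ.* n ℕ.+ 8 ℕ.* n) f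
      ≡⟨ ∑-even-odd (8 ℕ.* n) f ⟩
    ∑[ x < 8 ℕ.* n ] f (x ℕ.+ x) + ∑[ x < 8 ℕ.* n ] F x
      ≡⟨ cong₂ _+_ evens odds ⟩
    gauss (4 ℕ.* n) c′ + gauss (4 ℕ.* n) c′ + + 0
      ≡⟨ twice (gauss (4 ℕ.* n) c′) ⟩
    + 2 * gauss (4 ℕ.* n) c′ ∎
    where
    c  = + 1 + + 2 * s
    c′ = c * (+ 4 * P)
    N  = + n
    f : ℕ → ℤ
    f x = χ (c * P * (+ x * + x))
    g : ℕ → ℤ
    g x = χ (c′ * (+ x * + x))
    F : ℕ → ℤ
    F x = f (suc (x ℕ.+ x))

    twice : ∀ x → x + x + + 0 ≡ + 2 * x
    twice = solve-∀
    even-square : ∀ c P X → c * P * ((X + X) * (X + X)) ≡ c * (+ 4 * P) * (X * X)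
    even-square = solve-∀
    even-shift : ∀ c P N X → c * (+ 4 * P) * ((+ 4 * N + X) * (+ 4 * N + X)) ≡
                 c * (+ 4 * P) * (X * X) + c * (+ 2 * X + + 4 * N) * (+ 8 * P * N + + 8 * P * N)
    even-shift = solve-∀
    odd-shift : ∀ s P N X →
      (+ 1 + + 2 * s) * P * ((+ 1 + ((+ 2 * N + X) + (+ 2 * N + X))) * (+ 1 + ((+ 2 * N + X) + (+ 2 * N + X)))) ≡
      (+ 1 + + 2 * s) * P * ((+ 1 + (X + X)) * (+ 1 + (X + X))) + + 8 * P * N +
      (s + X + + 2 * s * X + (+ 1 + + 2 * s) * N) * (+ 8 * P * N + + 8 * P * N)
    odd-shift = solve-∀

    g-periodic : ∀ x → g (4 ℕ.* n ℕ.+ x) ≡ g x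
    g-periodic x = χ-mod hP (c * (+ 2 * + x + + 4 * N)) (begin
      c′ * (+ (4 ℕ.* n ℕ.+ x) * + (4 ℕ.* n ℕ.+ x))
        ≡⟨ cong (λ u → c′ * (u * u)) (pos-*+ 4 n x) ⟩
      c′ * ((+ 4 * N + + x) * (+ 4 * N + + x))
        ≡⟨ even-shift c P N (+ x) ⟩
      c′ * (+ x * + x) + c * (+ 2 * + x + + 4 * N) * (+ 8 * P * N + + 8 * P * N) ∎)

    evens : ∑[ x < 8 ℕ.* n ] f (x ℕ.+ x) ≡ gauss (4 ℕ.* n) c′ + gauss (4 ℕ.* n) c′
    evens = begin
      ∑[ x < 8 ℕ.* n ] f (x ℕ.+ x)
        ≡⟨ ∑-cong (8 ℕ.* n) (λ x _ →
             cong χ (trans (cong (λ u → c * P * (u * u)) (ℤ.pos-+ x x)) (even-square c P (+ x)))) ⟩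
      ∑< (8 ℕ.* n) g
        ≡⟨ cong (λ m → ∑< m g) (ℕ.*-distribʳ-+ n 4 4) ⟩
      ∑< (4 ℕ.* n ℕ.+ 4 ℕ.* n) g
        ≡⟨ ∑-periodic (4 ℕ.* n) g g-periodic ⟩
      ∑< (4 ℕ.* n) g + ∑< (4 ℕ.* n) g ∎

    F-antiperiodic : ∀ x → F (2 ℕ.* n ℕ.+ x) ≡ - F x
    F-antiperiodic x = χ-half hP (s + + x + + 2 * s * + x + c * N) (begin
      c * P * (+ suc (y ℕ.+ y) * + suc (y ℕ.+ y))
        ≡⟨ cong (λ u → c * P * (u * u)) (trans (pos-odd y) (cong (λ u → + 1 + (u + u)) (pos-*+ 2 n x))) ⟩
      c * P * ((+ 1 + ((+ 2 * N + + x) + (+ 2 * N + + x))) * (+ 1 + ((+ 2 * N + + x) + (+ 2 * N + + x))))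
        ≡⟨ odd-shift s P N (+ x) ⟩
      c * P * ((+ 1 + (+ x + + x)) * (+ 1 + (+ x + + x))) + + 8 * P * N +
        (s + + x + + 2 * s * + x + c * N) * (+ 8 * P * N + + 8 * P * N)
        ≡⟨ cong (λ u → c * P * (u * u) + + 8 * P * N + (s + + x + + 2 * s * + x + c * N) * (+ 8 * P * N + + 8 * P * N))
             (sym (pos-odd x)) ⟩
      c * P * (+ suc (x ℕ.+ x) * + suc (x ℕ.+ x)) + + 8 * P * N +
        (s + + x + + 2 * s * + x + c * N) * (+ 8 * P * N + + 8 * P * N) ∎)
      where y = 2 ℕ.* n ℕ.+ x

    F-periodic : ∀ x → F (4 ℕ.* n ℕ.+ x) ≡ F x
    F-periodic x = begin
      F (4 ℕ.* n ℕ.+ x)               ≡⟨ cong F (trans (cong (ℕ._+ x) (ℕ.*-distribʳ-+ n 2 2))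
                                                       (ℕ.+-assoc (2 ℕ.* n) (2 ℕ.* n) x)) ⟩
      F (2 ℕ.* n ℕ.+ (2 ℕ.* n ℕ.+ x)) ≡⟨ F-antiperiodic _ ⟩
      - F (2 ℕ.* n ℕ.+ x)             ≡⟨ cong -_ (F-antiperiodic x) ⟩
      - - F x                         ≡⟨ ℤ.neg-involutive (F x) ⟩
      F x                             ∎

    odds : ∑< (8 ℕ.* n) F ≡ + 0
    odds = begin
      ∑< (8 ℕ.* n) F                    ≡⟨ cong (λ m → ∑< m F) (ℕ.*-distribʳ-+ n 4 4) ⟩
      ∑< (4 ℕ.* n ℕ.+ 4 ℕ.* n) F          ≡⟨ ∑-periodic (4 ℕ.* n) F F-periodic ⟩
      ∑< (4 ℕ.* n) F + ∑< (4 ℕ.* n) F     ≡⟨ cong (λ m → ∑< m F + ∑< m F) (ℕ.*-distribʳ-+ n 2 2) ⟩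
      ∑< (2 ℕ.* n ℕ.+ 2 ℕ.* n) F + ∑< (2 ℕ.* n ℕ.+ 2 ℕ.* n) F
        ≡⟨ cong₂ _+_ (∑-antiperiodic (2 ℕ.* n) F F-antiperiodic) (∑-antiperiodic (2 ℕ.* n) F F-antiperiodic) ⟩
      + 0                                ∎

  gauss-iterate : ∀ {c} s → c ≡ + 1 + + 2 * s → ∀ q j P → + h ≡ + 2 * + q * P * + (4 ℕ.^ j) →
    gauss (4 ℕ.* q ℕ.* 4 ℕ.^ j) (c * P) ≡ + (2 ℕ.^ j) * gauss (4 ℕ.* q) (c * (P * + (4 ℕ.^ j)))
  gauss-iterate {c} s c≡ q zero P hP = begin
    gauss (4 ℕ.* q ℕ.* 1) (c * P)          ≡⟨ cong₂ gauss (ℕ.*-identityʳ (4 ℕ.* q)) (cong (c *_) (sym (ℤ.*-identityʳ P))) ⟩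
    gauss (4 ℕ.* q) (c * (P * + 1))        ≡⟨ sym (ℤ.*-identityˡ _) ⟩
    + 1 * gauss (4 ℕ.* q) (c * (P * + 1))  ∎
  gauss-iterate {c} s c≡ q (suc j) P hP = begin
    gauss (4 ℕ.* q ℕ.* (4 ℕ.* Q)) (c * P)
      ≡⟨ cong (λ N → gauss N (c * P)) (bound q Q) ⟩
    gauss (16 ℕ.* (q ℕ.* Q)) (c * P)
      ≡⟨ gauss-descent s c≡ P (q ℕ.* Q) h≡8Pn ⟩
    + 2 * gauss (4 ℕ.* (q ℕ.* Q)) (c * (+ 4 * P))
      ≡⟨ cong (λ N → + 2 * gauss N (c * (+ 4 * P))) (sym (ℕ.*-assoc 4 q Q)) ⟩
    + 2 * gauss (4 ℕ.* q ℕ.* Q) (c * (+ 4 * P))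
      ≡⟨ cong (+ 2 *_) (gauss-iterate s c≡ q j (+ 4 * P) h≡2q4PQ) ⟩
    + 2 * (+ (2 ℕ.^ j) * gauss (4 ℕ.* q) (c * (+ 4 * P * + Q)))
      ≡⟨ sym (ℤ.*-assoc (+ 2) (+ (2 ℕ.^ j)) _) ⟩
    + 2 * + (2 ℕ.^ j) * gauss (4 ℕ.* q) (c * (+ 4 * P * + Q))
      ≡⟨ cong (_* gauss (4 ℕ.* q) (c * (+ 4 * P * + Q))) (sym (ℤ.pos-* 2 (2 ℕ.^ j))) ⟩
    + (2 ℕ.^ suc j) * gauss (4 ℕ.* q) (c * (+ 4 * P * + Q))
      ≡⟨ cong (λ u → + (2 ℕ.^ suc j) * gauss (4 ℕ.* q) (c * u)) (trans (four-comm P (+ Q)) (cong (P *_) (sym (ℤ.pos-* 4 Q)))) ⟩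
    + (2 ℕ.^ suc j) * gauss (4 ℕ.* q) (c * (P * + (4 ℕ.* Q))) ∎
    where
    Q = 4 ℕ.^ j
    bound : ∀ q Q → 4 ℕ.* q ℕ.* (4 ℕ.* Q) ≡ 16 ℕ.* (q ℕ.* Q)
    bound = ℕ-solve-∀
    four-comm : ∀ P Q → + 4 * P * Q ≡ P * (+ 4 * Q)
    four-comm = solve-∀
    h≡8Pn : + h ≡ + 8 * P * + (q ℕ.* Q)
    h≡8Pn = begin
      + h                             ≡⟨ hP ⟩
      + 2 * + q * P * + (4 ℕ.* Q)     ≡⟨ cong (+ 2 * + q * P *_) (ℤ.pos-* 4 Q) ⟩
      + 2 * + q * P * (+ 4 * + Q)     ≡⟨ regroup (+ q) P (+ Q) ⟩
      + 8 * P * (+ q * + Q)           ≡⟨ cong (+ 8 * P *_) (sym (ℤ.pos-* q Q)) ⟩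
      + 8 * P * + (q ℕ.* Q)           ∎
      where
      regroup : ∀ q P Q → + 2 * q * P * (+ 4 * Q) ≡ + 8 * P * (q * Q)
      regroup = solve-∀
    h≡2q4PQ : + h ≡ + 2 * + q * (+ 4 * P) * + Q
    h≡2q4PQ = trans hP (trans (cong (+ 2 * + q * P *_) (ℤ.pos-* 4 Q)) (regroup (+ q) P (+ Q)))
      where
      regroup : ∀ q P Q → + 2 * q * P * (+ 4 * Q) ≡ + 2 * q * (+ 4 * P) * Q
      regroup = solve-∀

<ᵇ-true : ∀ {m n} → m < n → (m ℕ.<ᵇ n) ≡ true
<ᵇ-true m<n = Equivalence.to T-≡ (ℕ.<⇒<ᵇ m<n)

<ᵇ-false : ∀ {m n} → n ≤ m → (m ℕ.<ᵇ n) ≡ false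
<ᵇ-false {m} {n} n≤m = ¬-not (λ m<ᵇn → ℕ.<⇒≱ (ℕ.<ᵇ⇒< m n (Equivalence.from T-≡ m<ᵇn)) n≤m)

-- The i-th coordinate of ζ^z, for z ∈ ℤ; G is evaluated one coordinate at a time.
coord : (k : ℕ) → Fin (pow2 (k ℕ.∸ 1)) → ℤ → ℤ
coord k i z = root k (z modℤ2^ k) i

2^[1+n]≡2^n+2^n : ∀ n → pow2 (suc n) ≡ pow2 n ℕ.+ pow2 n
2^[1+n]≡2^n+2^n n = cong (pow2 n ℕ.+_) (ℕ.+-identityʳ (pow2 n))

module _ (k' : ℕ) (i : Fin (pow2 k')) where
  private
    k = suc k'
    h = pow2 k'
    M = pow2 k
    instance
      M≢0 : NonZero M
      M≢0 = pow2-nonZero k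

  root-+half : ∀ r → r < h → root k (r ℕ.+ h) i ≡ - root k r i
  root-+half r r<h
    rewrite m<n⇒m%n≡m (subst (r ℕ.+ h <_) (sym (2^[1+n]≡2^n+2^n k')) (ℕ.+-monoˡ-< h r<h))
          | m<n⇒m%n≡m (ℕ.<-≤-trans r<h (ℕ.m≤m+n h (h ℕ.+ 0)))
          | <ᵇ-false (ℕ.m≤n+m h r) | <ᵇ-true r<h | ℕ.m+n∸n≡m r h
    with toℕ i ℕ.≡ᵇ r
  ... | true  = refl
  ... | false = refl

  root-+half-mod : ∀ z r q → r < M → z ≡ + r + q * + M → root k ((z + + h) modℤ2^ k) i ≡ - root k r i
  root-+half-mod z r q r<M z≡ with r ℕ.<? h
  ... | yes r<h = trans (cong (λ r → root k r i) (%ℕ-unique M q r+h<M z+h≡)) (root-+half r r<h)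
    where
    r+h<M : r ℕ.+ h < M
    r+h<M = subst (r ℕ.+ h <_) (sym (2^[1+n]≡2^n+2^n k')) (ℕ.+-monoˡ-< h r<h)
    z+h≡ : z + + h ≡ + (r ℕ.+ h) + q * + M
    z+h≡ = begin
      z + + h                 ≡⟨ cong (_+ + h) z≡ ⟩
      + r + q * + M + + h     ≡⟨ swap (+ r) (q * + M) (+ h) ⟩
      + r + + h + q * + M     ≡⟨ cong (_+ q * + M) (sym (ℤ.pos-+ r h)) ⟩
      + (r ℕ.+ h) + q * + M   ∎
      where
      swap : ∀ a b c → a + b + c ≡ a + c + b
      swap = solve-∀
  ... | no r≮h = begin
    root k ((z + + h) modℤ2^ k) i ≡⟨ cong (λ r → root k r i) (%ℕ-unique M (q + + 1) d<M z+h≡) ⟩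
    root k d i                    ≡⟨ sym (ℤ.neg-involutive _) ⟩
    - - root k d i                ≡⟨ cong -_ (sym (root-+half d d<h)) ⟩
    - root k (d ℕ.+ h) i          ≡⟨ cong (λ r → - root k r i) (ℕ.m∸n+n≡m h≤r) ⟩
    - root k r i                  ∎
    where
    h≤r = ℕ.≮⇒≥ r≮h
    d = r ℕ.∸ h
    d<h : d < h
    d<h = ℕ.+-cancelʳ-< h d h (subst (_< h ℕ.+ h) (sym (ℕ.m∸n+n≡m h≤r))
                                     (subst (r <_) (2^[1+n]≡2^n+2^n k') r<M))
    d<M : d < M
    d<M = ℕ.<-≤-trans d<h (ℕ.m≤m+n h (h ℕ.+ 0))
    z+h≡ : z + + h ≡ + d + (q + + 1) * + M
    z+h≡ = begin
      z + + h                               ≡⟨ cong (_+ + h) z≡ ⟩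
      + r + q * + M + + h                   ≡⟨ cong₂ (λ a b → a + q * b + + h) +r≡ +M≡ ⟩
      + d + + h + q * (+ h + + h) + + h     ≡⟨ regroup (+ d) (+ h) q ⟩
      + d + (q + + 1) * (+ h + + h)         ≡⟨ cong (λ b → + d + (q + + 1) * b) (sym +M≡) ⟩
      + d + (q + + 1) * + M                 ∎
      where
      +r≡ : + r ≡ + d + + h
      +r≡ = trans (cong +_ (sym (ℕ.m∸n+n≡m h≤r))) (ℤ.pos-+ d h)
      +M≡ : + M ≡ + h + + h
      +M≡ = trans (cong +_ (2^[1+n]≡2^n+2^n k')) (ℤ.pos-+ h h)
      regroup : ∀ d h q → d + h + q * (h + h) + h ≡ d + (q + + 1) * (h + h)
      regroup = solve-∀

  coord-antiperiodic : ∀ z → coord k i (z + + h) ≡ - coord k i z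
  coord-antiperiodic z = root-+half-mod z _ (z /ℕ M) (n%ℕd<d z M) (a≡a%ℕn+[a/ℕn]*n z M)

root≡coord : ∀ k n i → root k n i ≡ coord k i (+ n)
root≡coord k n i = cong select (sym (m%n%n≡m%n n (pow2 k) {{pow2-nonZero k}}))
  where
  select : ℕ → ℤ
  select r = if r ℕ.<ᵇ pow2 (k ℕ.∸ 1)
               then (if toℕ i ℕ.≡ᵇ r then + 1 else + 0)
               else (if toℕ i ℕ.≡ᵇ (r ℕ.∸ pow2 (k ℕ.∸ 1)) then - (+ 1) else + 0)

-- Square roots of 1 modulo powers of 2

even⊎odd : ∀ n → (∃[ t ] n ≡ t ℕ.+ t) ⊎ (∃[ t ] n ≡ suc (t ℕ.+ t))
even⊎odd zero = inj₁ (0 , refl)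
even⊎odd (suc n) with even⊎odd n
... | inj₁ (t , refl) = inj₂ (t , refl)
... | inj₂ (t , refl) = inj₁ (suc t , cong suc (sym (ℕ.+-suc t t)))

2∤odd : ∀ m → ¬ 2 ∣ suc (m ℕ.+ m)
2∤odd m 2∣odd = contradiction (∣1⇒≡1 (∣m+n∣m⇒∣n 2∣1+m+m (divides m (double m)))) (λ ())
  where
  2∣1+m+m : 2 ∣ (m ℕ.+ m) ℕ.+ 1
  2∣1+m+m = subst (2 ∣_) (ℕ.+-comm 1 (m ℕ.+ m)) 2∣odd
  double : ∀ m → m ℕ.+ m ≡ m ℕ.* 2
  double = ℕ-solve-∀

odd*odd : ∀ t f → suc (t ℕ.+ t) ℕ.* suc (f ℕ.+ f) ≡
                  suc ((t ℕ.+ f ℕ.+ 2 ℕ.* t ℕ.* f) ℕ.+ (t ℕ.+ f ℕ.+ 2 ℕ.* t ℕ.* f))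
odd*odd = ℕ-solve-∀

2^∣odd*⇒2^∣ : ∀ n t e → 2 ℕ.^ n ∣ suc (t ℕ.+ t) ℕ.* e → 2 ℕ.^ n ∣ e
2^∣odd*⇒2^∣ zero    t e _ = 1∣ e
2^∣odd*⇒2^∣ (suc n) t e 2^n∣ with even⊎odd e
... | inj₁ (f , refl) = subst (2 ℕ.^ suc n ∣_) (twice f) (*-monoʳ-∣ 2 (2^∣odd*⇒2^∣ n t f (*-cancelˡ-∣ 2 2^n∣′)))
  where
  twice : ∀ f → 2 ℕ.* f ≡ f ℕ.+ f
  twice = ℕ-solve-∀
  regroup : ∀ t f → suc (t ℕ.+ t) ℕ.* (f ℕ.+ f) ≡ 2 ℕ.* (suc (t ℕ.+ t) ℕ.* f)
  regroup = ℕ-solve-∀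
  2^n∣′ : 2 ℕ.* 2 ℕ.^ n ∣ 2 ℕ.* (suc (t ℕ.+ t) ℕ.* f)
  2^n∣′ = subst (2 ℕ.^ suc n ∣_) (regroup t f) 2^n∣
... | inj₂ (f , refl) = contradiction (subst (2 ∣_) (odd*odd t f) (∣-trans (m∣m*n (2 ℕ.^ n)) 2^n∣))
                                      (2∤odd (t ℕ.+ f ℕ.+ 2 ℕ.* t ℕ.* f))

2^∣consecutive : ∀ n w → w < 2 ℕ.^ n → 2 ℕ.^ n ∣ w ℕ.* suc w → w ≡ 0 ⊎ suc w ≡ 2 ℕ.^ n
2^∣consecutive n w w<P P∣ with even⊎odd w
... | inj₁ (z , w≡) = inj₁ (∣∧<⇒≡0 w (2^∣odd*⇒2^∣ n z w P∣[1+2z]w) w<P)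
  where
  P∣[1+2z]w : 2 ℕ.^ n ∣ suc (z ℕ.+ z) ℕ.* w
  P∣[1+2z]w = subst (λ x → 2 ℕ.^ n ∣ suc x ℕ.* w) w≡ (subst (2 ℕ.^ n ∣_) (ℕ.*-comm w (suc w)) P∣)
... | inj₂ (z , w≡) =
  inj₂ (ℕ.≤-antisym w<P (∣⇒≤ (2^∣odd*⇒2^∣ n z (suc w) (subst (λ x → 2 ℕ.^ n ∣ x ℕ.* suc w) w≡ P∣))))

square≡1-mod-2^ : ∀ k' u → u < pow2 (suc k') → pow2 (suc (suc k')) ∣ ∣ u ℕ.* u ⊖ 1 ∣ →
                  u ≡ 1 ⊎ u ≡ pow2 (suc k') ℕ.∸ 1
square≡1-mod-2^ k' zero _ D∣ = contradiction (∣-trans (m∣m*n (pow2 (suc k'))) D∣) (2∤odd 0)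
square≡1-mod-2^ k' (suc v) u<M D∣ with even⊎odd v
... | inj₂ (w , refl) = contradiction (subst (2 ∣_) (odd-square w) (∣-trans (m∣m*n (pow2 (suc k'))) D∣))
                                      (2∤odd (2 ℕ.* w ℕ.* w ℕ.+ 4 ℕ.* w ℕ.+ 1))
  where
  odd-square : ∀ w → suc (w ℕ.+ w) ℕ.+ suc (w ℕ.+ w) ℕ.* suc (suc (w ℕ.+ w)) ≡
               suc ((2 ℕ.* w ℕ.* w ℕ.+ 4 ℕ.* w ℕ.+ 1) ℕ.+ (2 ℕ.* w ℕ.* w ℕ.+ 4 ℕ.* w ℕ.+ 1))
  odd-square = ℕ-solve-∀
... | inj₁ (w , refl) = Sum.map (cong (λ x → suc (x ℕ.+ x)))
                                (λ 1+w≡h → trans (u≡ w) (cong (λ x → x ℕ.+ (x ℕ.+ 0) ℕ.∸ 1) 1+w≡h))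
                                (2^∣consecutive k' w w<h h∣w*sw)
  where
  w<h : w < pow2 k'
  w<h = ℕ.≰⇒> λ h≤w → ℕ.<-irrefl refl (ℕ.<-≤-trans u<M
          (ℕ.≤-trans (ℕ.+-mono-≤ h≤w (ℕ.≤-trans (ℕ.≤-reflexive (ℕ.+-identityʳ (pow2 k'))) h≤w)) (ℕ.n≤1+n _)))
  even-square : ∀ w → (w ℕ.+ w) ℕ.+ (w ℕ.+ w) ℕ.* suc (w ℕ.+ w) ≡ 4 ℕ.* (w ℕ.* suc w)
  even-square = ℕ-solve-∀
  h∣w*sw : pow2 k' ∣ w ℕ.* suc w
  h∣w*sw = *-cancelˡ-∣ 4 (subst₂ _∣_ (sym (ℕ.*-assoc 2 2 (pow2 k'))) (even-square w) D∣)
  u≡ : ∀ w → suc (w ℕ.+ w) ≡ w ℕ.+ (suc w ℕ.+ 0)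
  u≡ = ℕ-solve-∀

odd⇒∣a∣≡1+2t : ∀ a → Odd a → ∃[ t ] ∣ a ∣ ≡ suc (t ℕ.+ t)
odd⇒∣a∣≡1+2t a odd = half ∣ a ∣ (∣a∣%2≡1 a odd)
  where
  ∣a∣%2≡1 : ∀ a → Odd a → ∣ a ∣ % 2 ≡ 1
  ∣a∣%2≡1 (+ n)    odd = odd
  ∣a∣%2≡1 -[1+ n ] odd with suc n % 2 | m%n<n (suc n) 2
  ... | 1 | _ = refl
  ∣a∣%2≡1 -[1+ n ] () | 0 | _
  ... | suc (suc _) | s≤s (s≤s ())
  half : ∀ n → n % 2 ≡ 1 → ∃[ t ] n ≡ suc (t ℕ.+ t)
  half n n%2≡1 = n / 2 , trans (m≡m%n+[m/n]*n n 2) (trans (cong (ℕ._+ n / 2 ℕ.* 2) n%2≡1) (odd-form (n / 2)))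
    where
    odd-form : ∀ t → 1 ℕ.+ t ℕ.* 2 ≡ suc (t ℕ.+ t)
    odd-form = ℕ-solve-∀

∈-allVecs : ∀ m l (v : Vec (Fin m) l) → v ∈ allVecs m l
∈-allVecs m zero    []      = here refl
∈-allVecs m (suc l) (i ∷ v) =
  ∈-concatMap⁺ (λ j → map (j ∷_) (allVecs m l)) (lose (∈-allFin i) (∈-map⁺ (i ∷_) (∈-allVecs m l v)))

∈-bfilter⁺ : ∀ {X : Set} (p : X → Bool) {x} xs → x ∈ xs → T (p x) → x ∈ bfilter p xs
∈-bfilter⁺ p (y ∷ xs) (here refl) px with p y
... | true = here refl
∈-bfilter⁺ p (y ∷ xs) (there x∈) px with p y
... | true  = there (∈-bfilter⁺ p xs x∈ px)
... | false = ∈-bfilter⁺ p xs x∈ px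

∈-bfilter⁻ : ∀ {X : Set} (p : X → Bool) {x} xs → x ∈ bfilter p xs → T (p x)
∈-bfilter⁻ p (y ∷ xs) x∈ with p y in py
∈-bfilter⁻ p (y ∷ xs) (here refl) | true = Equivalence.from T-≡ py
∈-bfilter⁻ p (y ∷ xs) (there x∈)  | true = ∈-bfilter⁻ p xs x∈
... | false = ∈-bfilter⁻ p xs x∈

module _ (k : ℕ) (p : A k → Bool) where

  all-allA⁺ : (∀ x → T (p x)) → T (all p (allA k))
  all-allA⁺ px = all⁻ p {allA k} (All.tabulate (λ {x} _ → px x))

  all-allA⁻ : T (all p (allA k)) → ∀ x → T (p x)
  all-allA⁻ t x = All.lookup (all⁺ p (allA k) t) (∈-allFin x)

T-∧-intro : ∀ {b c} → T b → T c → T (b ∧ c)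
T-∧-intro tb tc = Equivalence.from T-∧ (tb , tc)

T-implies : ∀ {b c} → (T b → T c) → T (not b ∨ c)
T-implies {true}  b⇒c = b⇒c tt
T-implies {false} _   = tt

T-implies⁻ : ∀ {b c} → T (not b ∨ c) → T b → T c
T-implies⁻ {true} tc _ = tc

T-ext : ∀ {b c} → (T b → T c) → (T c → T b) → b ≡ c
T-ext {true}  {true}  _   _   = refl
T-ext {true}  {false} b⇒c _   = contradiction (b⇒c tt) λ ()
T-ext {false} {true}  _   c⇒b = contradiction (c⇒b tt) λ ()
T-ext {false} {false} _   _   = refl

sumC-bfilter : ∀ {k} {X : Set} n (g : Fin n → X) (f : X → Cyc k) (p : X → Bool) i (F : ℕ → ℤ) →
               (∀ x → (if p (g x) then f (g x) i else + 0) ≡ F (toℕ x)) →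
               sumC {k} f (bfilter p (Data.List.tabulate g)) i ≡ ∑< n F
sumC-bfilter         zero    g f p i F eq = refl
sumC-bfilter {k} (suc n) g f p i F eq with p (g Fin.zero) | eq Fin.zero
... | true  | eq₀ = cong₂ _+_ eq₀ (sumC-bfilter {k} n (g ∘ Fin.suc) f p i (F ∘ suc) (eq ∘ Fin.suc))
... | false | eq₀ = trans (sumC-bfilter {k} n (g ∘ Fin.suc) f p i (F ∘ suc) (eq ∘ Fin.suc))
                          (trans (sym (ℤ.+-identityˡ _)) (cong (_+ ∑< n (F ∘ suc)) eq₀))

if-∨ : ∀ b c (v : ℤ) → ¬ (T b × T c) →
       (if b ∨ c then v else + 0) ≡ (if b then v else + 0) + (if c then v else + 0)
if-∨ true  true  v both = contradiction (tt , tt) both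
if-∨ true  false v _    = sym (ℤ.+-identityʳ v)
if-∨ false c     v _    = sym (ℤ.+-identityˡ _)

if-∨-idem : ∀ b (v : ℤ) → (if b ∨ b then v else + 0) ≡ (if b then v else + 0)
if-∨-idem true  v = refl
if-∨-idem false v = refl

-- The isometries of A_{2^k,a} are ±1

module _ (k' : ℕ) where
  private
    k = suc k'
    M = pow2 k
    h = pow2 k'
    instance
      M≢0 : NonZero M
      M≢0 = pow2-nonZero k

  1<M : 1 < M
  1<M = ℕ.+-mono-≤ (ℕ.m^n>0 2 k') (ℕ.≤-trans (ℕ.m^n>0 2 k') (ℕ.m≤m+n h 0))

  one : A k
  one = fromℕ< 1<M

  toℕ-plusA : ∀ x y → toℕ (plusA k x y) ≡ (toℕ x ℕ.+ toℕ y) % M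
  toℕ-plusA x y = Fin.toℕ-fromℕ< _

  plusA-one : ∀ {n} (n<M : n < M) (1+n<M : suc n < M) → plusA k (fromℕ< n<M) one ≡ fromℕ< 1+n<M
  plusA-one {n} n<M 1+n<M = Fin.toℕ-injective (begin
    toℕ (plusA k (fromℕ< n<M) one)  ≡⟨ toℕ-plusA (fromℕ< n<M) one ⟩
    (toℕ (fromℕ< n<M) ℕ.+ toℕ one) % M ≡⟨ cong₂ (λ x y → (x ℕ.+ y) % M) (Fin.toℕ-fromℕ< n<M) (Fin.toℕ-fromℕ< 1<M) ⟩
    (n ℕ.+ 1) % M                  ≡⟨ cong (_% M) (ℕ.+-comm n 1) ⟩
    suc n % M                      ≡⟨ m<n⇒m%n≡m 1+n<M ⟩
    suc n                          ≡⟨ Fin.toℕ-fromℕ< 1+n<M ⟨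
    toℕ (fromℕ< 1+n<M)             ∎)

  mulMap : ℕ → Map k
  mulMap u = tabulate (λ x → fromℕ< (m%n<n (toℕ x ℕ.* u) M))

  toℕ-mulMap : ∀ u x → toℕ (app {k} (mulMap u) x) ≡ (toℕ x ℕ.* u) % M
  toℕ-mulMap u x = trans (cong toℕ (lookup∘tabulate _ x)) (Fin.toℕ-fromℕ< _)

  module _ (σ : Map k) (σ-hom : T (isHom k σ)) where
    private
      σ′ : A k → ℕ
      σ′ = toℕ ∘ app {k} σ
      u = σ′ one

    σ-+ : ∀ x y → σ′ (plusA k x y) ≡ (σ′ x ℕ.+ σ′ y) % M
    σ-+ x y = ℕ.≡ᵇ⇒≡ _ _ (all-allA⁻ k (λ y → σ′ (plusA k x y) ℕ.≡ᵇ addA k (σ′ x) (σ′ y))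
                                  (all-allA⁻ k _ σ-hom x) y)

    σ-zero : (0<M : 0 < M) → σ′ (fromℕ< 0<M) ≡ 0
    σ-zero 0<M = [s+s]%d≡s⇒s≡0 (σ′ z) M (Fin.toℕ<n _) (begin
      (σ′ z ℕ.+ σ′ z) % M ≡⟨ σ-+ z z ⟨
      σ′ (plusA k z z)    ≡⟨ cong σ′ z+z≡z ⟩
      σ′ z                ∎)
      where
      z = fromℕ< 0<M
      z+z≡z : plusA k z z ≡ z
      z+z≡z = Fin.toℕ-injective (trans (toℕ-plusA z z)
                (trans (cong (λ x → (x ℕ.+ x) % M) (Fin.toℕ-fromℕ< 0<M))
                  (trans (m<n⇒m%n≡m 0<M) (sym (Fin.toℕ-fromℕ< 0<M)))))

    σ-suc : ∀ n (1+n<M : suc n < M) → σ′ (fromℕ< 1+n<M) ≡ (suc n ℕ.* u) % M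
    σ-suc zero    _      = sym (trans (cong (_% M) (ℕ.+-identityʳ u)) (m<n⇒m%n≡m (Fin.toℕ<n _)))
    σ-suc (suc n) 2+n<M = begin
      σ′ (fromℕ< 2+n<M)                    ≡⟨ cong σ′ (plusA-one 1+n<M 2+n<M) ⟨
      σ′ (plusA k (fromℕ< 1+n<M) one)       ≡⟨ σ-+ _ _ ⟩
      (σ′ (fromℕ< 1+n<M) ℕ.+ u) % M         ≡⟨ cong (λ x → (x ℕ.+ u) % M) (σ-suc n 1+n<M) ⟩
      ((suc n ℕ.* u) % M ℕ.+ u) % M         ≡⟨ [m%d+n]%d≡[m+n]%d (suc n ℕ.* u) u M ⟩
      (suc n ℕ.* u ℕ.+ u) % M               ≡⟨ cong (_% M) (ℕ.+-comm (suc n ℕ.* u) u) ⟩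
      (suc (suc n) ℕ.* u) % M               ∎
      where
      1+n<M : suc n < M
      1+n<M = ℕ.<-trans (ℕ.n<1+n (suc n)) 2+n<M

    hom⇒mul : ∀ x → σ′ x ≡ (toℕ x ℕ.* u) % M
    hom⇒mul x = trans (cong σ′ (sym (Fin.fromℕ<-toℕ x (Fin.toℕ<n x)))) (at (toℕ x) (Fin.toℕ<n x))
      where
      at : ∀ n (n<M : n < M) → σ′ (fromℕ< n<M) ≡ (n ℕ.* u) % M
      at zero    0<M   = trans (σ-zero 0<M) (sym (m<n⇒m%n≡m 0<M))
      at (suc n) 1+n<M = σ-suc n 1+n<M

  neg : ℕ → ℕ
  neg x = (M ℕ.∸ x) % M

  neg-zero : neg 0 ≡ 0
  neg-zero = n%n≡0 M

  neg-suc : ∀ {y} → suc y < M → neg (suc y) ≡ M ℕ.∸ suc y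
  neg-suc 1+y<M = m<n⇒m%n≡m (ℕ.∸-monoʳ-< (s≤s z≤n) (ℕ.<⇒≤ 1+y<M))

  neg-involutive : ∀ x → x < M → neg (neg x) ≡ x
  neg-involutive zero    _     = trans (cong neg neg-zero) neg-zero
  neg-involutive (suc y) 1+y<M = begin
    neg (neg (suc y))              ≡⟨ cong neg (neg-suc 1+y<M) ⟩
    (M ℕ.∸ (M ℕ.∸ suc y)) % M      ≡⟨ cong (_% M) (ℕ.m∸[m∸n]≡n (ℕ.<⇒≤ 1+y<M)) ⟩
    suc y % M                      ≡⟨ m<n⇒m%n≡m 1+y<M ⟩
    suc y                          ∎

  *[M∸1]≡neg : ∀ x → x < M → (x ℕ.* (M ℕ.∸ 1)) % M ≡ neg x
  *[M∸1]≡neg zero    0<M   = trans (m<n⇒m%n≡m 0<M) (sym neg-zero)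
  *[M∸1]≡neg (suc y) 1+y<M = begin
    (suc y ℕ.* (M ℕ.∸ 1)) % M          ≡⟨ cong (λ m → (suc y ℕ.* (m ℕ.∸ 1)) % M) M≡ ⟩
    (suc y ℕ.* (y ℕ.+ d)) % M          ≡⟨ cong (_% M) (expand y d) ⟩
    (d ℕ.+ y ℕ.* (suc y ℕ.+ d)) % M    ≡⟨ cong (λ m → (d ℕ.+ y ℕ.* m) % M) M≡ ⟨
    (d ℕ.+ y ℕ.* M) % M                ≡⟨ [m+kn]%n≡m%n d y M ⟩
    d % M                              ∎
    where
    d = M ℕ.∸ suc y
    M≡ : M ≡ suc y ℕ.+ d
    M≡ = sym (ℕ.m+[n∸m]≡n (ℕ.<⇒≤ 1+y<M))
    expand : ∀ y d → suc y ℕ.* (y ℕ.+ d) ≡ d ℕ.+ y ℕ.* (suc y ℕ.+ d)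
    expand = ℕ-solve-∀

  neg-preserves-q : ∀ a n → n < M → (a * + (neg n ℕ.* neg n)) modℤ2^ suc k ≡ (a * + (n ℕ.* n)) modℤ2^ suc k
  neg-preserves-q a zero    _     = cong (λ m → (a * + (m ℕ.* m)) modℤ2^ suc k) neg-zero
  neg-preserves-q a (suc y) 1+y<M = begin
    (a * + (neg n ℕ.* neg n)) modℤ2^ suc k        ≡⟨ cong (λ t → (a * t) modℤ2^ suc k) +neg² ⟩
    (a * ((H + H - X) * (H + H - X))) modℤ2^ suc k ≡⟨ cong (_modℤ2^ suc k) (reflect a H X) ⟩
    (a * (X * X) + a * (H - X) * ((H + H) + (H + H))) modℤ2^ suc k
                                                  ≡⟨ cong (λ d → (a * (X * X) + a * (H - X) * d) modℤ2^ suc k) +D ⟨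
    (a * (X * X) + a * (H - X) * + D) modℤ2^ suc k ≡⟨ %ℕ-periodic D {{pow2-nonZero (suc k)}} (a * (X * X)) (a * (H - X)) ⟩
    (a * (X * X)) modℤ2^ suc k                    ≡⟨ cong (λ t → (a * t) modℤ2^ suc k) (ℤ.pos-* n n) ⟨
    (a * + (n ℕ.* n)) modℤ2^ suc k                ∎
    where
    n = suc y
    H = + h
    X = + n
    D = pow2 (suc k)
    reflect : ∀ a H X → a * ((H + H - X) * (H + H - X)) ≡ a * (X * X) + a * (H - X) * ((H + H) + (H + H))
    reflect = solve-∀
    +M : + M ≡ H + H
    +M = trans (cong +_ (2^[1+n]≡2^n+2^n k')) (ℤ.pos-+ h h)
    +D : + D ≡ (H + H) + (H + H)
    +D = trans (cong +_ (2^[1+n]≡2^n+2^n k)) (trans (ℤ.pos-+ M M) (cong (λ t → t + t) +M))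
    +neg² : + (neg n ℕ.* neg n) ≡ (H + H - X) * (H + H - X)
    +neg² = trans (ℤ.pos-* (neg n) (neg n)) (cong (λ t → t * t) (begin
      + neg n        ≡⟨ cong +_ (neg-suc 1+y<M) ⟩
      + (M ℕ.∸ n)    ≡⟨ ℤ.⊖-≥ (ℕ.<⇒≤ 1+y<M) ⟨
      M ⊖ n          ≡⟨ ℤ.[+m]-[+n]≡m⊖n M n ⟨
      + M - X        ≡⟨ cong (_- X) +M ⟩
      H + H - X      ∎))

  module _ (a : ℤ) (u : ℕ) (inv : ∀ x → x < M → ((x ℕ.* u) % M ℕ.* u) % M ≡ x)
           (pres : ∀ x → qA k a (app {k} (mulMap u) x) ≡ qA k a x) where
    private
      τ = mulMap u
      τ′ : A k → ℕ
      τ′ = toℕ ∘ app {k} τ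

      τ-involutive : ∀ x → (τ′ x ℕ.* u) % M ≡ toℕ x
      τ-involutive x = trans (cong (λ t → (t ℕ.* u) % M) (toℕ-mulMap u x)) (inv (toℕ x) (Fin.toℕ<n x))

      τ-+ : ∀ x y → τ′ (plusA k x y) ≡ addA k (τ′ x) (τ′ y)
      τ-+ x y = begin
        τ′ (plusA k x y)                             ≡⟨ toℕ-mulMap u (plusA k x y) ⟩
        (toℕ (plusA k x y) ℕ.* u) % M                ≡⟨ cong (λ t → (t ℕ.* u) % M) (toℕ-plusA x y) ⟩
        (((toℕ x ℕ.+ toℕ y) % M) ℕ.* u) % M          ≡⟨ [m%d*n]%d≡[m*n]%d (toℕ x ℕ.+ toℕ y) u M ⟩
        ((toℕ x ℕ.+ toℕ y) ℕ.* u) % M                ≡⟨ cong (_% M) (ℕ.*-distribʳ-+ u (toℕ x) (toℕ y)) ⟩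
        (toℕ x ℕ.* u ℕ.+ toℕ y ℕ.* u) % M            ≡⟨ %-distribˡ-+ (toℕ x ℕ.* u) (toℕ y ℕ.* u) M ⟩
        ((toℕ x ℕ.* u) % M ℕ.+ (toℕ y ℕ.* u) % M) % M ≡⟨ cong₂ (λ p q → (p ℕ.+ q) % M) (toℕ-mulMap u x) (toℕ-mulMap u y) ⟨
        addA k (τ′ x) (τ′ y)                         ∎

      τ-injective : ∀ x y → τ′ x ≡ τ′ y → toℕ x ≡ toℕ y
      τ-injective x y eq = trans (sym (τ-involutive x)) (trans (cong (λ t → (t ℕ.* u) % M) eq) (τ-involutive y))

      τ-surjective : ∀ y → τ′ (app {k} τ y) ≡ toℕ y
      τ-surjective y = trans (toℕ-mulMap u (app {k} τ y)) (τ-involutive y)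

    mulMap∈OA : mulMap u ∈ OA k a
    mulMap∈OA = ∈-bfilter⁺ (isIsometry k a) _ (∈-allVecs _ _ τ)
      (T-∧-intro hom (T-∧-intro (T-∧-intro injective surjective) preserves))
      where
      hom : T (isHom k τ)
      hom = all-allA⁺ k _ λ x → all-allA⁺ k _ λ y → ℕ.≡⇒≡ᵇ _ _ (τ-+ x y)
      injective : T (all (λ x → all (λ y → not (τ′ x ℕ.≡ᵇ τ′ y) ∨ (toℕ x ℕ.≡ᵇ toℕ y)) (allA k)) (allA k))
      injective = all-allA⁺ k _ λ x → all-allA⁺ k _ λ y →
        T-implies (λ eqᵇ → ℕ.≡⇒≡ᵇ _ _ (τ-injective x y (ℕ.≡ᵇ⇒≡ _ _ eqᵇ)))
      surjective : T (all (λ y → any (λ x → τ′ x ℕ.≡ᵇ toℕ y) (allA k)) (allA k))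
      surjective = all-allA⁺ k _ λ y → any⁺ _ (lose (∈-allFin (app {k} τ y)) (ℕ.≡⇒≡ᵇ _ _ (τ-surjective y)))
      preserves : T (preservesQ k a τ)
      preserves = all-allA⁺ k _ λ x → ℕ.≡⇒≡ᵇ _ _ (pres x)

  *1≡id : ∀ x → x < M → (x ℕ.* 1) % M ≡ x
  *1≡id x x<M = trans (cong (_% M) (ℕ.*-identityʳ x)) (m<n⇒m%n≡m x<M)

  toℕ-idMap : ∀ x → toℕ (app {k} (mulMap 1) x) ≡ toℕ x
  toℕ-idMap x = trans (toℕ-mulMap 1 x) (*1≡id (toℕ x) (Fin.toℕ<n x))

  toℕ-negMap : ∀ x → toℕ (app {k} (mulMap (M ℕ.∸ 1)) x) ≡ neg (toℕ x)
  toℕ-negMap x = trans (toℕ-mulMap (M ℕ.∸ 1) x) (*[M∸1]≡neg (toℕ x) (Fin.toℕ<n x))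

  idMap∈OA : ∀ a → mulMap 1 ∈ OA k a
  idMap∈OA a = mulMap∈OA a 1 inv (λ x → cong (λ t → (a * + (t ℕ.* t))  modℤ2^ suc k) (toℕ-idMap x))
    where
    inv : ∀ x → x < M → ((x ℕ.* 1) % M ℕ.* 1) % M ≡ x
    inv x x<M = trans (cong (λ t → (t ℕ.* 1) % M) (*1≡id x x<M)) (*1≡id x x<M)

  negMap∈OA : ∀ a → mulMap (M ℕ.∸ 1) ∈ OA k a
  negMap∈OA a = mulMap∈OA a (M ℕ.∸ 1) inv pres
    where
    inv : ∀ x → x < M → ((x ℕ.* (M ℕ.∸ 1)) % M ℕ.* (M ℕ.∸ 1)) % M ≡ x
    inv x x<M = begin
      ((x ℕ.* (M ℕ.∸ 1)) % M ℕ.* (M ℕ.∸ 1)) % M ≡⟨ cong (λ t → (t ℕ.* (M ℕ.∸ 1)) % M) (*[M∸1]≡neg x x<M) ⟩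
      (neg x ℕ.* (M ℕ.∸ 1)) % M                 ≡⟨ *[M∸1]≡neg (neg x) (m%n<n (M ℕ.∸ x) M) ⟩
      neg (neg x)                               ≡⟨ neg-involutive x x<M ⟩
      x                                         ∎
    pres : ∀ x → qA k a (app {k} (mulMap (M ℕ.∸ 1)) x) ≡ qA k a x
    pres x = trans (cong (λ t → (a * + (t ℕ.* t)) modℤ2^ suc k) (toℕ-negMap x))
                   (neg-preserves-q a (toℕ x) (Fin.toℕ<n x))

  -- σ is multiplication by u = σ(1), and q(u) = q(1) with a odd gives 2^(k+1) ∣ u² - 1.
  isometry⇒±1 : ∀ a → Odd a → ∀ σ → σ ∈ OA k a → ∀ x →
                toℕ (app {k} σ x) ≡ toℕ x ⊎ toℕ (app {k} σ x) ≡ neg (toℕ x)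
  isometry⇒±1 a odd σ σ∈OA x =
    Sum.map (λ u≡1 → trans σx≡ (trans (cong (λ v → (toℕ x ℕ.* v) % M) u≡1) (*1≡id (toℕ x) (Fin.toℕ<n x))))
            (λ u≡M∸1 → trans σx≡ (trans (cong (λ v → (toℕ x ℕ.* v) % M) u≡M∸1) (*[M∸1]≡neg (toℕ x) (Fin.toℕ<n x))))
            (square≡1-mod-2^ k' u (Fin.toℕ<n _) D∣u²-1)
    where
    D = pow2 (suc k)
    instance
      D≢0 : NonZero D
      D≢0 = pow2-nonZero (suc k)
    isometry = Equivalence.to T-∧ (∈-bfilter⁻ (isIsometry k a) (allVecs M M) σ∈OA)
    preserves : T (preservesQ k a σ)
    preserves = proj₂ (Equivalence.to T-∧ (proj₂ isometry))
    u = toℕ (app {k} σ one)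
    σx≡ : toℕ (app {k} σ x) ≡ (toℕ x ℕ.* u) % M
    σx≡ = hom⇒mul σ (proj₁ isometry) x
    q-one : (a * + (u ℕ.* u)) %ℕ D ≡ (a * + 1) %ℕ D
    q-one = trans (ℕ.≡ᵇ⇒≡ _ _ (all-allA⁻ k _ preserves one))
                  (cong (λ t → (a * + (t ℕ.* t)) modℤ2^ suc k) (Fin.toℕ-fromℕ< 1<M))
    factor : a * + (u ℕ.* u) - a * + 1 ≡ a * (u ℕ.* u ⊖ 1)
    factor = trans (distrib a (+ (u ℕ.* u))) (cong (a *_) (ℤ.[+m]-[+n]≡m⊖n (u ℕ.* u) 1))
      where
      distrib : ∀ a x → a * x - a * + 1 ≡ a * (x - + 1)
      distrib = solve-∀
    D∣a[u²-1] : D ∣ ∣ a ∣ ℕ.* ∣ u ℕ.* u ⊖ 1 ∣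
    D∣a[u²-1] = subst (D ∣_) (trans (cong ∣_∣ factor) (ℤ.abs-* a _))
                      (%ℕ-≡⇒∣- D (a * + (u ℕ.* u)) (a * + 1) q-one)
    D∣u²-1 : D ∣ ∣ u ℕ.* u ⊖ 1 ∣
    D∣u²-1 = 2^∣odd*⇒2^∣ (suc k) (proj₁ (odd⇒∣a∣≡1+2t a odd)) _
               (subst (λ m → D ∣ m ℕ.* ∣ u ℕ.* u ⊖ 1 ∣) (proj₂ (odd⇒∣a∣≡1+2t a odd)) D∣a[u²-1])

  orbit : ℕ → ℕ → Bool
  orbit x y = (y ℕ.≡ᵇ x) ∨ (y ℕ.≡ᵇ neg x)

  inOrbit≡orbit : ∀ a → Odd a → ∀ x y → inOrbit k a x y ≡ orbit (toℕ x) (toℕ y)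
  inOrbit≡orbit a odd x y = T-ext to from
    where
    to : T (inOrbit k a x y) → T (orbit (toℕ x) (toℕ y))
    to t = let σ , σ∈OA , σx≡ᵇy = find (any⁻ _ (OA k a) t)
               σx≡y = ℕ.≡ᵇ⇒≡ _ _ σx≡ᵇy
           in Equivalence.from T-∨ (Sum.map (λ σx≡x → ℕ.≡⇒≡ᵇ _ _ (trans (sym σx≡y) σx≡x))
                                            (λ σx≡-x → ℕ.≡⇒≡ᵇ _ _ (trans (sym σx≡y) σx≡-x))
                                            (isometry⇒±1 a odd σ σ∈OA x))
    from : T (orbit (toℕ x) (toℕ y)) → T (inOrbit k a x y)
    from t = Sum.[ (λ y≡ᵇx → any⁺ _ (lose (idMap∈OA a)
                     (ℕ.≡⇒≡ᵇ _ _ (trans (toℕ-idMap x) (sym (ℕ.≡ᵇ⇒≡ _ _ y≡ᵇx))))))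
                 , (λ y≡ᵇ-x → any⁺ _ (lose (negMap∈OA a)
                     (ℕ.≡⇒≡ᵇ _ _ (trans (toℕ-negMap x) (sym (ℕ.≡ᵇ⇒≡ _ _ y≡ᵇ-x))))))
                 ]′ (Equivalence.to T-∨ t)

  h<M : h < M
  h<M = subst (h <_) (sym (2^[1+n]≡2^n+2^n k')) (ℕ.m<m+n h (ℕ.m^n>0 2 k'))

  ≤h⇒≤neg : ∀ x → x ≤ h → x ≤ neg x
  ≤h⇒≤neg zero    _    = z≤n
  ≤h⇒≤neg (suc y) 1+y≤h = subst (suc y ≤_) (sym (neg-suc (ℕ.≤-<-trans 1+y≤h h<M)))
    (ℕ.m+n≤o⇒m≤o∸n (suc y) (subst (suc y ℕ.+ suc y ≤_) (sym (2^[1+n]≡2^n+2^n k')) (ℕ.+-mono-≤ 1+y≤h 1+y≤h)))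

  >h⇒neg< : ∀ x → h < x → x < M → neg x < x
  >h⇒neg< (suc y) h<1+y 1+y<M = subst (_< suc y) (sym (neg-suc 1+y<M))
    (ℕ.m<n+o⇒m∸n<o M (suc y) (subst (_< suc y ℕ.+ suc y) (sym (2^[1+n]≡2^n+2^n k')) (ℕ.+-mono-< h<1+y h<1+y)))

  isRep≡≤h : ∀ a → Odd a → ∀ x → isRep k a x ≡ (toℕ x ℕ.≤ᵇ h)
  isRep≡≤h a odd x = T-ext to from
    where
    X = toℕ x
    orbit⇒inOrbit : ∀ y → T (orbit X (toℕ y)) → T (inOrbit k a x y)
    orbit⇒inOrbit y = subst T (sym (inOrbit≡orbit a odd x y))
    -- For h < x, the orbit of x contains neg x < x.
    to : T (isRep k a x) → T (X ℕ.≤ᵇ h)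
    to rep = ℕ.≤⇒≤ᵇ (ℕ.≮⇒≥ λ h<X → ℕ.<⇒≱ (>h⇒neg< X h<X (Fin.toℕ<n x))
               (subst (X ≤_) (Fin.toℕ-fromℕ< -x<M)
                 (ℕ.≤ᵇ⇒≤ _ _ (T-implies⁻ (all-allA⁻ k _ rep -x)
                   (orbit⇒inOrbit -x (Equivalence.from T-∨ (inj₂ (ℕ.≡⇒≡ᵇ _ _ (Fin.toℕ-fromℕ< -x<M)))))))))
      where
      -x<M = m%n<n (M ℕ.∸ X) M
      -x = fromℕ< -x<M
    from : T (X ℕ.≤ᵇ h) → T (isRep k a x)
    from X≤ᵇh = all-allA⁺ k _ λ y → T-implies λ x~y → ℕ.≤⇒≤ᵇ
      (Sum.[ (λ y≡ᵇX → ℕ.≤-reflexive (sym (ℕ.≡ᵇ⇒≡ _ _ y≡ᵇX)))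
           , (λ y≡ᵇ-X → subst (X ≤_) (sym (ℕ.≡ᵇ⇒≡ _ _ y≡ᵇ-X)) (≤h⇒≤neg X (ℕ.≤ᵇ⇒≤ _ _ X≤ᵇh)))
           ]′ (Equivalence.to T-∨ (subst T (inOrbit≡orbit a odd x y) x~y)))

-- G as a sum over orbits

module _ (k' : ℕ) (a : ℤ) (odd : Odd a) (i : Fin (pow2 k')) where
  private
    k = suc k'
    M = pow2 k
    h = pow2 k'
    χ = coord k i
    instance
      M≢0 : NonZero M
      M≢0 = pow2-nonZero k

  open GaussSums χ (coord-antiperiodic k' i)

  orbitSum : ℕ → ℤ
  orbitSum m = ∑[ y < M ] (if orbit k' m y then χ (a * + (m ℕ.* y)) else + 0)

  G≡∑orbitSum : G k a i ≡ ∑[ m < M ] (if m ℕ.≤ᵇ h then orbitSum m else + 0)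
  G≡∑orbitSum = sumC-bfilter {k} M id inner (isRep k a) i _ λ x →
    trans (cong (λ b → if b then inner x i else + 0) (isRep≡≤h k' a odd x))
          (cong (λ v → if toℕ x ℕ.≤ᵇ h then v else + 0) (inner≡ x))
    where
    inner : A k → Cyc k
    inner x = sumC {k} (λ y → eA k a x y) (bfilter (inOrbit k a x) (allA k))
    inner≡ : ∀ x → inner x i ≡ orbitSum (toℕ x)
    inner≡ x = sumC-bfilter {k} M id (eA k a x) (inOrbit k a x) i _ λ y →
      cong (λ b → if b then eA k a x y i else + 0) (inOrbit≡orbit k' a odd x y)

  orbitSum-fixed : ∀ m → m < M → neg k' m ≡ m → orbitSum m ≡ χ (a * + (m ℕ.* m))
  orbitSum-fixed m m<M -m≡m = trans
    (∑-cong M λ y _ → trans (cong (λ n → if (y ℕ.≡ᵇ m) ∨ (y ℕ.≡ᵇ n) then χ (a * + (m ℕ.* y)) else + 0) -m≡m)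
                            (if-∨-idem (y ℕ.≡ᵇ m) _))
    (∑-indicator M m (λ y → χ (a * + (m ℕ.* y))) m<M)

  orbitSum-pair : ∀ m → m < M → neg k' m ≢ m → orbitSum m ≡ χ (a * + (m ℕ.* m)) + χ (a * + (m ℕ.* neg k' m))
  orbitSum-pair m m<M -m≢m = begin
    orbitSum m
      ≡⟨ ∑-cong M (λ y _ → if-∨ (y ℕ.≡ᵇ m) (y ℕ.≡ᵇ neg k' m) _ λ (y≡m , y≡-m) →
                             -m≢m (trans (sym (ℕ.≡ᵇ⇒≡ y _ y≡-m)) (ℕ.≡ᵇ⇒≡ y m y≡m))) ⟩
    ∑[ y < M ] ((if y ℕ.≡ᵇ m then f y else + 0) + (if y ℕ.≡ᵇ neg k' m then f y else + 0))
      ≡⟨ ∑-distrib-+ M _ _ ⟩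
    ∑[ y < M ] (if y ℕ.≡ᵇ m then f y else + 0) + ∑[ y < M ] (if y ℕ.≡ᵇ neg k' m then f y else + 0)
      ≡⟨ cong₂ _+_ (∑-indicator M m f m<M) (∑-indicator M (neg k' m) f (m%n<n (M ℕ.∸ m) M)) ⟩
    f m + f (neg k' m) ∎
    where
    f : ℕ → ℤ
    f y = χ (a * + (m ℕ.* y))

  private
    f : ℤ → ℕ → ℤ
    f c x = χ (c * (+ x * + x))
    h₁ = ℕ.pred h
    h≡1+h₁ : h ≡ suc h₁
    h≡1+h₁ = sym (ℕ.suc-pred h {{pow2-nonZero k'}})
    ∑<h : ∀ F → ∑< h F ≡ F 0 + ∑[ x < h₁ ] F (suc x)
    ∑<h F = cong (λ n → ∑< n F) h≡1+h₁
    +h+h∸ : ∀ s → s ≤ h ℕ.+ h → + (h ℕ.+ h ℕ.∸ s) ≡ + h + + h - + s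
    +h+h∸ s s≤ = trans (sym (ℤ.⊖-≥ s≤)) (trans (sym (ℤ.[+m]-[+n]≡m⊖n (h ℕ.+ h) s)) (cong (_- + s) (ℤ.pos-+ h h)))

  G-form : G k a i ≡ f a 0 + ∑[ x < h₁ ] (f a (suc x) + f (- a) (suc x)) + (f a h + + 0)
  G-form = begin
    G k a i                                   ≡⟨ G≡∑orbitSum ⟩
    ∑< M F                                    ≡⟨ cong (λ n → ∑< n F) (2^[1+n]≡2^n+2^n k') ⟩
    ∑< (h ℕ.+ h) F                            ≡⟨ ∑-split h h F ⟩
    ∑< h F + ∑[ x < h ] F (h ℕ.+ x)           ≡⟨ cong₂ _+_ (∑<h F) (∑<h (λ x → F (h ℕ.+ x))) ⟩
    (F 0 + ∑[ x < h₁ ] F (suc x)) + (F (h ℕ.+ 0) + ∑[ x < h₁ ] F (h ℕ.+ suc x))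
      ≡⟨ cong₂ _+_ (cong₂ _+_ F0 (∑-cong h₁ Fsuc)) (cong₂ _+_ Fh (∑-vanishing h₁ λ x _ → F-high (ℕ.m<m+n h (s≤s z≤n)))) ⟩
    f a 0 + ∑[ x < h₁ ] (f a (suc x) + f (- a) (suc x)) + (f a h + + 0) ∎
    where
    F : ℕ → ℤ
    F m = if m ℕ.≤ᵇ h then orbitSum m else + 0
    F-low : ∀ {m} → m ≤ h → F m ≡ orbitSum m
    F-low {m} m≤h = cong (λ b → if b then orbitSum m else + 0) (Equivalence.to T-≡ (ℕ.≤⇒≤ᵇ m≤h))
    F-high : ∀ {m} → h < m → F m ≡ + 0
    F-high {m} h<m = cong (λ b → if b then orbitSum m else + 0) (¬-not λ m≤ᵇh → ℕ.<⇒≱ h<m (ℕ.≤ᵇ⇒≤ m h (Equivalence.from T-≡ m≤ᵇh)))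
    F0 : F 0 ≡ f a 0
    F0 = trans (F-low z≤n) (orbitSum-fixed 0 (ℕ.≤-<-trans z≤n (h<M k')) (neg-zero k'))
    Fh : F (h ℕ.+ 0) ≡ f a h
    Fh = begin
      F (h ℕ.+ 0)              ≡⟨ cong F (ℕ.+-identityʳ h) ⟩
      F h                      ≡⟨ F-low ℕ.≤-refl ⟩
      orbitSum h               ≡⟨ orbitSum-fixed h (h<M k') -h≡h ⟩
      χ (a * + (h ℕ.* h))      ≡⟨ cong (λ t → χ (a * t)) (ℤ.pos-* h h) ⟩
      f a h                    ∎
      where
      -h≡h : neg k' h ≡ h
      -h≡h = trans (cong (λ m → (m ℕ.∸ h) % M) (2^[1+n]≡2^n+2^n k')) (trans (cong (_% M) (ℕ.m+n∸n≡m h h)) (m<n⇒m%n≡m (h<M k')))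
    Fsuc : ∀ x → x < h₁ → F (suc x) ≡ f a (suc x) + f (- a) (suc x)
    Fsuc x x<h₁ = begin
      F s                                      ≡⟨ F-low (ℕ.<⇒≤ s<h) ⟩
      orbitSum s                               ≡⟨ orbitSum-pair s s<M -s≢s ⟩
      χ (a * + (s ℕ.* s)) + χ (a * + (s ℕ.* neg k' s))
        ≡⟨ cong₂ (λ p q → χ (a * p) + χ (a * + (s ℕ.* q))) (ℤ.pos-* s s) (neg-suc k' s<M) ⟩
      f a s + χ (a * + (s ℕ.* (M ℕ.∸ s)))        ≡⟨ cong (λ t → f a s + t) (χ-mod refl (a * + s) {w = - a * (+ s * + s)} (begin
        a * + (s ℕ.* (M ℕ.∸ s))                     ≡⟨ cong (a *_) (trans (ℤ.pos-* s _) (cong (+ s *_) M∸s)) ⟩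
        a * (+ s * (+ h + + h - + s))               ≡⟨ mirror a (+ s) (+ h) ⟩
        - a * (+ s * + s) + a * + s * (+ h + + h)   ∎)) ⟩
      f a s + f (- a) s                        ∎
      where
      s = suc x
      s<h : s < h
      s<h = subst (s <_) (sym h≡1+h₁) (s≤s x<h₁)
      s<M : s < M
      s<M = ℕ.<-trans s<h (h<M k')
      M∸s : + (M ℕ.∸ s) ≡ + h + + h - + s
      M∸s = trans (cong (λ m → + (m ℕ.∸ s)) (2^[1+n]≡2^n+2^n k')) (+h+h∸ s (subst (s ≤_) (2^[1+n]≡2^n+2^n k') (ℕ.<⇒≤ s<M)))
      -s≢s : neg k' s ≢ s
      -s≢s -s≡s = ℕ.<-irrefl s+s≡h+h (ℕ.+-mono-< s<h s<h)
        where
        s+s≡h+h : s ℕ.+ s ≡ h ℕ.+ h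
        s+s≡h+h = trans (cong (s ℕ.+_) (sym (trans (sym (neg-suc k' s<M)) -s≡s)))
                        (trans (ℕ.m+[n∸m]≡n (ℕ.<⇒≤ s<M)) (2^[1+n]≡2^n+2^n k'))
      mirror : ∀ a s h → a * (s * (h + h - s)) ≡ - a * (s * s) + a * s * (h + h)
      mirror = solve-∀

  gauss-form : ∀ c → gauss M c ≡ f c 0 + ∑[ x < h₁ ] f c (suc x) + (∑[ x < h₁ ] f c (suc x) + f c h)
  gauss-form c = begin
    ∑< M (f c)                                      ≡⟨ cong (λ n → ∑< n (f c)) (2^[1+n]≡2^n+2^n k') ⟩
    ∑< (h ℕ.+ h) (f c)                              ≡⟨ ∑-split h h (f c) ⟩
    ∑< h (f c) + ∑[ x < h ] f c (h ℕ.+ x)           ≡⟨ cong₂ _+_ (∑<h (f c)) (sym (∑-reverse h (λ x → f c (h ℕ.+ x)))) ⟩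
    f c 0 + ∑[ x < h₁ ] f c (suc x) + ∑[ x < h ] f c (h ℕ.+ (h ℕ.∸ suc x))
                                                    ≡⟨ cong (λ t → f c 0 + ∑[ x < h₁ ] f c (suc x) + t) (∑-cong h reflect) ⟩
    f c 0 + ∑[ x < h₁ ] f c (suc x) + ∑[ x < h ] f c (suc x)
                                                    ≡⟨ cong (λ t → f c 0 + ∑[ x < h₁ ] f c (suc x) + t) upper ⟩
    f c 0 + ∑[ x < h₁ ] f c (suc x) + (∑[ x < h₁ ] f c (suc x) + f c h) ∎
    where
    upper : ∑[ x < h ] f c (suc x) ≡ ∑[ x < h₁ ] f c (suc x) + f c h
    upper = trans (cong (λ n → ∑< n (f c ∘ suc)) h≡1+h₁)
                  (trans (∑-last h₁ (f c ∘ suc)) (cong (λ n → ∑[ x < h₁ ] f c (suc x) + f c n) (sym h≡1+h₁)))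
    reflect : ∀ x → x < h → f c (h ℕ.+ (h ℕ.∸ suc x)) ≡ f c (suc x)
    reflect x x<h = χ-mod refl (c * (+ h + + h - + 2 * S)) {w = c * (S * S)} (begin
      c * (+ (h ℕ.+ (h ℕ.∸ suc x)) * + (h ℕ.+ (h ℕ.∸ suc x)))
        ≡⟨ cong (λ t → c * (t * t)) (trans (cong +_ (sym (ℕ.+-∸-assoc h x<h))) (+h+h∸ (suc x) (ℕ.≤-trans x<h (ℕ.m≤n+m h h)))) ⟩
      c * ((+ h + + h - S) * (+ h + + h - S))
        ≡⟨ square-mirror c S (+ h) ⟩
      c * (S * S) + c * (+ h + + h - + 2 * S) * (+ h + + h) ∎)
      where
      S = + suc x
      square-mirror : ∀ c s h → c * ((h + h - s) * (h + h - s)) ≡ c * (s * s) + c * (h + h - + 2 * s) * (h + h)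
      square-mirror = solve-∀

  -- Folding at h: the orbits are {x, M - x}, and 0 and h occur once in G but twice in each
  -- Gauss sum.
  two-G : + 2 * G k a i ≡ gauss M a + gauss M (- a)
  two-G = begin
    + 2 * G k a i
      ≡⟨ cong (+ 2 *_) (trans G-form (cong (λ t → f a 0 + t + (f a h + + 0)) (∑-distrib-+ h₁ (f a ∘ suc) (f (- a) ∘ suc)))) ⟩
    + 2 * (F₀ + (U + V) + (Fₕ + + 0))
      ≡⟨ regroup F₀ U V Fₕ ⟩
    (F₀ + U + (U + Fₕ)) + (F₀ + V + (V + Fₕ))
      ≡⟨ cong₂ (λ p q → (F₀ + U + (U + Fₕ)) + (p + V + (V + q))) F₀≡ Fₕ≡ ⟩
    (F₀ + U + (U + Fₕ)) + (f (- a) 0 + V + (V + f (- a) h))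
      ≡⟨ cong₂ _+_ (gauss-form a) (gauss-form (- a)) ⟨
    gauss M a + gauss M (- a) ∎
    where
    F₀ = f a 0
    Fₕ = f a h
    U = ∑[ x < h₁ ] f a (suc x)
    V = ∑[ x < h₁ ] f (- a) (suc x)
    regroup : ∀ F₀ U V Fₕ → + 2 * (F₀ + (U + V) + (Fₕ + + 0)) ≡ (F₀ + U + (U + Fₕ)) + (F₀ + V + (V + Fₕ))
    regroup = solve-∀
    F₀≡ : F₀ ≡ f (- a) 0
    F₀≡ = cong χ (trans (ℤ.*-zeroʳ a) (sym (ℤ.*-zeroʳ (- a))))
    Fₕ≡ : Fₕ ≡ f (- a) h
    Fₕ≡ = χ-mod refl (a * + h) {w = - a * (+ h * + h)} (flip a (+ h))
      where
      flip : ∀ a h → a * (h * h) ≡ - a * (h * h) + a * h * (h + h)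
      flip = solve-∀

module _ (k' : ℕ) (a : ℤ) (odd : Odd a) (i : Fin (pow2 k')) where
  private
    k = suc k'
    M = pow2 k

odd⇒a≡1+2s : ∀ a → Odd a → a ≡ + 1 + + 2 * (a /ℕ 2)
odd⇒a≡1+2s a odd = trans (a≡a%ℕn+[a/ℕn]*n a 2)
  (trans (cong (λ r → + r + (a /ℕ 2) * + 2) odd) (cong (λ t → + 1 + t) (ℤ.*-comm (a /ℕ 2) (+ 2))))

neg-odd : ∀ {a} s → a ≡ + 1 + + 2 * s → - a ≡ + 1 + + 2 * (- + 1 - s)
neg-odd s refl = negate s
  where
  negate : ∀ s → - (+ 1 + + 2 * s) ≡ + 1 + + 2 * (- + 1 - s)
  negate = solve-∀

jacobi2² : ∀ a → jacobi2 a * jacobi2 a ≡ + 1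
jacobi2² a with a %ℕ 8
... | 1 = refl
... | 7 = refl
... | 0 = refl
... | 2 = refl
... | 3 = refl
... | 4 = refl
... | 5 = refl
... | 6 = refl
... | suc (suc (suc (suc (suc (suc (suc (suc _))))))) = refl

^-even : ∀ x n → x * x ≡ + 1 → x ^ (n ℕ.+ n) ≡ + 1
^-even x n x²≡1 = begin
  x ^ (n ℕ.+ n)  ≡⟨ cong (λ m → x ^ (n ℕ.+ m)) (sym (ℕ.+-identityʳ n)) ⟩
  x ^ (2 ℕ.* n)  ≡⟨ ℤ.^-*-assoc x 2 n ⟨
  (x ^ 2) ^ n    ≡⟨ cong (_^ n) (trans (cong (x *_) (ℤ.*-identityʳ x)) x²≡1) ⟩
  (+ 1) ^ n      ≡⟨ ℤ.^-zeroˡ n ⟩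
  + 1            ∎

^-odd : ∀ x n → x * x ≡ + 1 → x ^ suc (n ℕ.+ n) ≡ x
^-odd x n x²≡1 = trans (cong (x *_) (^-even x n x²≡1)) (ℤ.*-identityʳ x)

2^[j+j]≡4^j : ∀ j → 2 ℕ.^ (j ℕ.+ j) ≡ 4 ℕ.^ j
2^[j+j]≡4^j j = trans (cong (λ m → 2 ℕ.^ (j ℕ.+ m)) (sym (ℕ.+-identityʳ j))) (sym (ℕ.^-*-assoc 2 2 j))

residue8-odd : ∀ a → Odd a → (a %ℕ 8) % 2 ≡ 1
residue8-odd a odd = trans (sym (%ℕ-unique 2 (+ (r / 2) + q * + 4) (m%n<n r 2) a≡)) odd
  where
  r = a %ℕ 8
  q = a /ℕ 8
  +r≡ : + r ≡ + (r % 2) + + (r / 2) * + 2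
  +r≡ = trans (cong +_ (m≡m%n+[m/n]*n r 2)) (trans (ℤ.pos-+ (r % 2) _) (cong (λ t → + (r % 2) + t) (ℤ.pos-* (r / 2) 2)))
  regroup : ∀ x y q → x + y * + 2 + q * + 8 ≡ x + (y + q * + 4) * + 2
  regroup = solve-∀
  a≡ : a ≡ + (r % 2) + (+ (r / 2) + q * + 4) * + 2
  a≡ = trans (a≡a%ℕn+[a/ℕn]*n a 8) (trans (cong (_+ q * + 8) +r≡) (regroup (+ (r % 2)) (+ (r / 2)) q))

jacobi2-residue : ∀ a → Odd a →
  (a %ℕ 8 ≡ 1 × jacobi2 a ≡ + 1) ⊎ (a %ℕ 8 ≡ 3 × jacobi2 a ≡ - + 1) ⊎
  (a %ℕ 8 ≡ 5 × jacobi2 a ≡ - + 1) ⊎ (a %ℕ 8 ≡ 7 × jacobi2 a ≡ + 1)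
jacobi2-residue a odd with a %ℕ 8 | n%ℕd<d a 8 | residue8-odd a odd
... | 1 | _ | _ = inj₁ (refl , refl)
... | 3 | _ | _ = inj₂ (inj₁ (refl , refl))
... | 5 | _ | _ = inj₂ (inj₂ (inj₁ (refl , refl)))
... | 7 | _ | _ = inj₂ (inj₂ (inj₂ (refl , refl)))
... | 0 | _ | ()
... | 2 | _ | ()
... | 4 | _ | ()
... | 6 | _ | ()
... | suc (suc (suc (suc (suc (suc (suc (suc _))))))) | s≤s (s≤s (s≤s (s≤s (s≤s (s≤s (s≤s (s≤s ()))))))) | _

sqrtA-even : ∀ k i → k % 2 ≡ 0 → sqrtA k i ≡ + (2 ℕ.^ (k / 2)) * root k 0 i
sqrtA-even k i k%2≡0 with k % 2
sqrtA-even k i refl | .0 = refl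

sqrtA-odd : ∀ k i → k % 2 ≡ 1 →
  sqrtA k i ≡ + (2 ℕ.^ ((k ℕ.∸ 1) / 2)) * (root k (pow2 (k ℕ.∸ 3)) i + root k (pow2 k ℕ.∸ pow2 (k ℕ.∸ 3)) i)
sqrtA-odd k i k%2≡1 with k % 2
sqrtA-odd k i refl | .1 = refl

module _ (j : ℕ) (i : Fin (pow2 (suc (j ℕ.+ j)))) where
  private
    K = suc (suc (j ℕ.+ j))
    M = pow2 K
    Q = 4 ℕ.^ j
    2ʲ = 2 ℕ.^ j
    χ = coord K i

  open GaussSums χ (coord-antiperiodic (suc (j ℕ.+ j)) i)

  h≡2Q : + pow2 (suc (j ℕ.+ j)) ≡ + 2 * + Q
  h≡2Q = trans (cong (λ n → + (2 ℕ.* n)) (2^[j+j]≡4^j j)) (ℤ.pos-* 2 Q)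

  gauss-even : ∀ {c} s → c ≡ + 1 + + 2 * s → gauss M c ≡ + 2ʲ * (+ 2 * χ (+ 0) + + 2 * χ (c * + Q))
  gauss-even {c} s c≡ = begin
    gauss M c                               ≡⟨ cong₂ gauss M≡ (sym (ℤ.*-identityʳ c)) ⟩
    gauss (4 ℕ.* 1 ℕ.* Q) (c * + 1)         ≡⟨ gauss-iterate s c≡ 1 j (+ 1) h≡2Q ⟩
    + 2ʲ * gauss 4 (c * (+ 1 * + Q))        ≡⟨ cong (λ w → + 2ʲ * gauss 4 (c * w)) (ℤ.*-identityˡ (+ Q)) ⟩
    + 2ʲ * gauss 4 (c * + Q)                ≡⟨ cong (+ 2ʲ *_) (gauss-4 c (+ Q) h≡2Q) ⟩
    + 2ʲ * (+ 2 * χ (+ 0) + + 2 * χ (c * + Q)) ∎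
    where
    M≡ : M ≡ 4 ℕ.* 1 ℕ.* Q
    M≡ = trans (cong (λ n → 2 ℕ.* (2 ℕ.* n)) (2^[j+j]≡4^j j)) (sym (ℕ.*-assoc 2 2 Q))

  χ[aQ]≡-χ[-aQ] : ∀ {a} s → a ≡ + 1 + + 2 * s → χ (a * + Q) ≡ - χ (- a * + Q)
  χ[aQ]≡-χ[-aQ] {a} s refl = χ-half h≡2Q s {w = - a * + Q} (flip s (+ Q))
    where
    flip : ∀ s Q → (+ 1 + + 2 * s) * Q ≡ - (+ 1 + + 2 * s) * Q + + 2 * Q + s * (+ 2 * Q + + 2 * Q)
    flip = solve-∀

  jacobi2^K*sqrtA-even : ∀ a → jacobi2 a ^ K * sqrtA K i ≡ + 2 * + 2ʲ * χ (+ 0)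
  jacobi2^K*sqrtA-even a = begin
    jacobi2 a ^ K * sqrtA K i
      ≡⟨ cong₂ _*_ (trans (cong (jacobi2 a ^_) (cong suc (sym (ℕ.+-suc j j)))) (^-even (jacobi2 a) (suc j) (jacobi2² a)))
                   (sqrtA-even K i K%2≡0) ⟩
    + 1 * (+ (2 ℕ.^ (K / 2)) * root K 0 i)
      ≡⟨ ℤ.*-identityˡ _ ⟩
    + (2 ℕ.^ (K / 2)) * root K 0 i
      ≡⟨ cong₂ (λ n r → + (2 ℕ.^ n) * r) K/2≡ (root≡coord K 0 i) ⟩
    + (2 ℕ.* 2ʲ) * χ (+ 0)
      ≡⟨ cong (_* χ (+ 0)) (ℤ.pos-* 2 2ʲ) ⟩
    + 2 * + 2ʲ * χ (+ 0) ∎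
    where
    double : ∀ j → suc (suc (j ℕ.+ j)) ≡ suc j ℕ.* 2
    double = ℕ-solve-∀
    K%2≡0 : K % 2 ≡ 0
    K%2≡0 = trans (cong (_% 2) (double j)) (m*n%n≡0 (suc j) 2)
    K/2≡ : K / 2 ≡ suc j
    K/2≡ = trans (cong (_/ 2) (double j)) (m*n/n≡m (suc j) 2)

  G-even : ∀ a → Odd a → G K a i ≡ jacobi2 a ^ K * sqrtA K i
  G-even a odd = ℤ.*-cancelˡ-≡ (+ 2) _ _ (begin
    + 2 * G K a i
      ≡⟨ two-G (suc (j ℕ.+ j)) a odd i ⟩
    gauss M a + gauss M (- a)
      ≡⟨ cong₂ _+_ (gauss-even s a≡) (gauss-even (- + 1 - s) (neg-odd s a≡)) ⟩
    + 2ʲ * (+ 2 * χ (+ 0) + + 2 * χ (a * + Q)) + + 2ʲ * (+ 2 * χ (+ 0) + + 2 * χ (- a * + Q))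
      ≡⟨ cong (λ t → + 2ʲ * (+ 2 * χ (+ 0) + + 2 * t) + + 2ʲ * (+ 2 * χ (+ 0) + + 2 * χ (- a * + Q)))
              (χ[aQ]≡-χ[-aQ] s a≡) ⟩
    + 2ʲ * (+ 2 * χ (+ 0) + + 2 * - χ (- a * + Q)) + + 2ʲ * (+ 2 * χ (+ 0) + + 2 * χ (- a * + Q))
      ≡⟨ cancel (+ 2ʲ) (χ (+ 0)) (χ (- a * + Q)) ⟩
    + 2 * (+ 2 * + 2ʲ * χ (+ 0))
      ≡⟨ cong (+ 2 *_) (jacobi2^K*sqrtA-even a) ⟨
    + 2 * (jacobi2 a ^ K * sqrtA K i) ∎)
    where
    s = a /ℕ 2
    a≡ = odd⇒a≡1+2s a odd
    cancel : ∀ t x y → t * (+ 2 * x + + 2 * - y) + t * (+ 2 * x + + 2 * y) ≡ + 2 * (+ 2 * t * x)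
    cancel = solve-∀

module _ (j : ℕ) (i : Fin (pow2 (suc (suc (j ℕ.+ j))))) where
  private
    K = suc (suc (suc (j ℕ.+ j)))
    h = pow2 (suc (suc (j ℕ.+ j)))
    M = pow2 K
    Q = 4 ℕ.^ j
    2ʲ = 2 ℕ.^ j
    χ = coord K i
    V = χ (+ Q) + χ (- + Q)

  open GaussSums χ (coord-antiperiodic (suc (suc (j ℕ.+ j))) i)

  h≡4Q : + h ≡ + 4 * + Q
  h≡4Q = trans (cong (λ n → + (2 ℕ.* (2 ℕ.* n))) (2^[j+j]≡4^j j)) (trans (cong +_ (sym (ℕ.*-assoc 2 2 Q))) (ℤ.pos-* 4 Q))

  M≡8Q : M ≡ 4 ℕ.* 2 ℕ.* Q
  M≡8Q = trans (cong (λ n → 2 ℕ.* (2 ℕ.* (2 ℕ.* n))) (2^[j+j]≡4^j j)) (eight Q)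
    where
    eight : ∀ Q → 2 ℕ.* (2 ℕ.* (2 ℕ.* Q)) ≡ 4 ℕ.* 2 ℕ.* Q
    eight = ℕ-solve-∀

  gauss-odd : ∀ {c} s → c ≡ + 1 + + 2 * s → gauss M c ≡ + 2ʲ * (+ 4 * χ (c * + Q))
  gauss-odd {c} s c≡ = begin
    gauss M c                               ≡⟨ cong₂ gauss M≡8Q (sym (ℤ.*-identityʳ c)) ⟩
    gauss (4 ℕ.* 2 ℕ.* Q) (c * + 1)         ≡⟨ gauss-iterate s c≡ 2 j (+ 1) h≡4Q ⟩
    + 2ʲ * gauss 8 (c * (+ 1 * + Q))        ≡⟨ cong (λ w → + 2ʲ * gauss 8 (c * w)) (ℤ.*-identityˡ (+ Q)) ⟩
    + 2ʲ * gauss 8 (c * + Q)                ≡⟨ cong (+ 2ʲ *_) (gauss-8 s c≡ (+ Q) h≡4Q) ⟩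
    + 2ʲ * (+ 4 * χ (c * + Q))              ∎

  χ-residue : ∀ a r → a %ℕ 8 ≡ r → χ (a * + Q) + χ (- a * + Q) ≡ χ (+ r * + Q) + χ (- + r * + Q)
  χ-residue a r a%8≡r = cong₂ _+_
    (χ-mod h≡4Q (a /ℕ 8) {w = + r * + Q} (shift a (+ r) (a /ℕ 8) (+ Q) a≡r+8q))
    (χ-mod h≡4Q (- (a /ℕ 8)) {w = - + r * + Q} (shift⁻ a (+ r) (a /ℕ 8) (+ Q) a≡r+8q))
    where
    a≡r+8q : a ≡ + r + a /ℕ 8 * + 8
    a≡r+8q = trans (a≡a%ℕn+[a/ℕn]*n a 8) (cong (λ n → + n + a /ℕ 8 * + 8) a%8≡r)
    shift′ : ∀ r q Q → (r + q * + 8) * Q ≡ r * Q + q * (+ 4 * Q + + 4 * Q)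
    shift′ = solve-∀
    shift : ∀ a r q Q → a ≡ r + q * + 8 → a * Q ≡ r * Q + q * (+ 4 * Q + + 4 * Q)
    shift a r q Q refl = shift′ r q Q
    shift⁻′ : ∀ r q Q → - (r + q * + 8) * Q ≡ - r * Q + - q * (+ 4 * Q + + 4 * Q)
    shift⁻′ = solve-∀
    shift⁻ : ∀ a r q Q → a ≡ r + q * + 8 → - a * Q ≡ - r * Q + - q * (+ 4 * Q + + 4 * Q)
    shift⁻ a r q Q refl = shift⁻′ r q Q

  -- The second supplementary law: ζ^(a Q) + ζ^(-a Q) = (2/a) (ζ^Q + ζ^(-Q)), with ζ^Q of order 8.
  χ-pair≡jacobi2 : ∀ a → Odd a → χ (a * + Q) + χ (- a * + Q) ≡ jacobi2 a * V
  χ-pair≡jacobi2 a odd = by-cases (jacobi2-residue a odd)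
    where
    by-residue : ∀ {r J p q} → a %ℕ 8 ≡ r → jacobi2 a ≡ J →
                 χ (+ r * + Q) ≡ p → χ (- + r * + Q) ≡ q → p + q ≡ J * V →
                 χ (a * + Q) + χ (- a * + Q) ≡ jacobi2 a * V
    by-residue {r} a%8≡r J≡ χ₊ χ₋ p+q≡ =
      trans (χ-residue a r a%8≡r) (trans (cong₂ _+_ χ₊ χ₋) (trans p+q≡ (cong (_* V) (sym J≡))))
    minus-one   : ∀ Q → - + 1 * Q ≡ - Q
    minus-one   = solve-∀
    three       : ∀ Q → + 3 * Q ≡ - Q + + 4 * Q + + 0 * (+ 4 * Q + + 4 * Q)
    three       = solve-∀
    minus-three : ∀ Q → - + 3 * Q ≡ Q + + 4 * Q + - + 1 * (+ 4 * Q + + 4 * Q)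
    minus-three = solve-∀
    five        : ∀ Q → + 5 * Q ≡ Q + + 4 * Q + + 0 * (+ 4 * Q + + 4 * Q)
    five        = solve-∀
    minus-five  : ∀ Q → - + 5 * Q ≡ - Q + + 4 * Q + - + 1 * (+ 4 * Q + + 4 * Q)
    minus-five  = solve-∀
    seven       : ∀ Q → + 7 * Q ≡ - Q + + 1 * (+ 4 * Q + + 4 * Q)
    seven       = solve-∀
    minus-seven : ∀ Q → - + 7 * Q ≡ Q + - + 1 * (+ 4 * Q + + 4 * Q)
    minus-seven = solve-∀
    -y-x : ∀ x y → - y + - x ≡ - + 1 * (x + y)
    -y-x = solve-∀
    -x-y : ∀ x y → - x + - y ≡ - + 1 * (x + y)
    -x-y = solve-∀
    y+x : ∀ x y → y + x ≡ + 1 * (x + y)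
    y+x = solve-∀
    by-cases : (a %ℕ 8 ≡ 1 × jacobi2 a ≡ + 1) ⊎ (a %ℕ 8 ≡ 3 × jacobi2 a ≡ - + 1) ⊎
               (a %ℕ 8 ≡ 5 × jacobi2 a ≡ - + 1) ⊎ (a %ℕ 8 ≡ 7 × jacobi2 a ≡ + 1) →
               χ (a * + Q) + χ (- a * + Q) ≡ jacobi2 a * V
    by-cases (inj₁ (a%8≡1 , J≡)) = by-residue a%8≡1 J≡
      (cong χ (ℤ.*-identityˡ (+ Q))) (cong χ (minus-one (+ Q))) (sym (ℤ.*-identityˡ V))
    by-cases (inj₂ (inj₁ (a%8≡3 , J≡))) = by-residue a%8≡3 J≡
      (χ-half h≡4Q (+ 0) {w = - + Q} (three (+ Q))) (χ-half h≡4Q (- + 1) {w = + Q} (minus-three (+ Q)))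
      (-y-x (χ (+ Q)) (χ (- + Q)))
    by-cases (inj₂ (inj₂ (inj₁ (a%8≡5 , J≡)))) = by-residue a%8≡5 J≡
      (χ-half h≡4Q (+ 0) {w = + Q} (five (+ Q))) (χ-half h≡4Q (- + 1) {w = - + Q} (minus-five (+ Q)))
      (-x-y (χ (+ Q)) (χ (- + Q)))
    by-cases (inj₂ (inj₂ (inj₂ (a%8≡7 , J≡)))) = by-residue a%8≡7 J≡
      (χ-mod h≡4Q (+ 1) {w = - + Q} (seven (+ Q))) (χ-mod h≡4Q (- + 1) {w = + Q} (minus-seven (+ Q)))
      (y+x (χ (+ Q)) (χ (- + Q)))

  jacobi2^K*sqrtA-odd : ∀ a → jacobi2 a ^ K * sqrtA K i ≡ jacobi2 a * (+ 2 * + 2ʲ * V)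
  jacobi2^K*sqrtA-odd a = begin
    jacobi2 a ^ K * sqrtA K i
      ≡⟨ cong₂ _*_ (trans (cong (jacobi2 a ^_) (cong (suc ∘ suc) (sym (ℕ.+-suc j j)))) (^-odd (jacobi2 a) (suc j) (jacobi2² a)))
                   (sqrtA-odd K i K%2≡1) ⟩
    jacobi2 a * (+ (2 ℕ.^ ((K ℕ.∸ 1) / 2)) * (root K (pow2 (j ℕ.+ j)) i + root K (M ℕ.∸ pow2 (j ℕ.+ j)) i))
      ≡⟨ cong (λ n → jacobi2 a * (+ (2 ℕ.^ n) * (root K (pow2 (j ℕ.+ j)) i + root K (M ℕ.∸ pow2 (j ℕ.+ j)) i)))
              [K∸1]/2≡ ⟩
    jacobi2 a * (+ (2 ℕ.* 2ʲ) * (root K (pow2 (j ℕ.+ j)) i + root K (M ℕ.∸ pow2 (j ℕ.+ j)) i))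
      ≡⟨ cong₂ (λ c v → jacobi2 a * (c * v)) (ℤ.pos-* 2 2ʲ) roots≡V ⟩
    jacobi2 a * (+ 2 * + 2ʲ * V) ∎
    where
    double : ∀ j → suc (suc (j ℕ.+ j)) ≡ suc j ℕ.* 2
    double = ℕ-solve-∀
    K%2≡1 : K % 2 ≡ 1
    K%2≡1 = trans (cong (λ n → suc n % 2) (double j)) ([m+kn]%n≡m%n 1 (suc j) 2)
    [K∸1]/2≡ : (K ℕ.∸ 1) / 2 ≡ suc j
    [K∸1]/2≡ = trans (cong (_/ 2) (double j)) (m*n/n≡m (suc j) 2)
    wrap : ∀ Q H → H + H - Q ≡ - Q + + 1 * (H + H)
    wrap = solve-∀
    M∸Q≡ : + (M ℕ.∸ Q) ≡ - + Q + + 1 * (+ h + + h)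
    M∸Q≡ = begin
      + (M ℕ.∸ Q)    ≡⟨ ℤ.⊖-≥ (subst (Q ≤_) (sym M≡8Q) (ℕ.m≤n*m Q (4 ℕ.* 2))) ⟨
      M ⊖ Q          ≡⟨ ℤ.[+m]-[+n]≡m⊖n M Q ⟨
      + M - + Q      ≡⟨ cong (_- + Q) (trans (cong +_ (2^[1+n]≡2^n+2^n (suc (suc (j ℕ.+ j))))) (ℤ.pos-+ h h)) ⟩
      + h + + h - + Q ≡⟨ wrap (+ Q) (+ h) ⟩
      - + Q + + 1 * (+ h + + h) ∎
    roots≡V : root K (pow2 (j ℕ.+ j)) i + root K (M ℕ.∸ pow2 (j ℕ.+ j)) i ≡ V
    roots≡V = cong₂ _+_
      (trans (cong (λ n → root K n i) (2^[j+j]≡4^j j)) (root≡coord K Q i))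
      (trans (cong (λ n → root K (M ℕ.∸ n) i) (2^[j+j]≡4^j j))
             (trans (root≡coord K (M ℕ.∸ Q) i) (χ-mod refl (+ 1) {w = - + Q} M∸Q≡)))

  G-odd : ∀ a → Odd a → G K a i ≡ jacobi2 a ^ K * sqrtA K i
  G-odd a odd = ℤ.*-cancelˡ-≡ (+ 2) _ _ (begin
    + 2 * G K a i
      ≡⟨ two-G (suc (suc (j ℕ.+ j))) a odd i ⟩
    gauss M a + gauss M (- a)
      ≡⟨ cong₂ _+_ (gauss-odd s a≡) (gauss-odd (- + 1 - s) (neg-odd s a≡)) ⟩
    + 2ʲ * (+ 4 * χ (a * + Q)) + + 2ʲ * (+ 4 * χ (- a * + Q))
      ≡⟨ collect (+ 2ʲ) (χ (a * + Q)) (χ (- a * + Q)) ⟩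
    + 2 * (+ 2 * + 2ʲ * (χ (a * + Q) + χ (- a * + Q)))
      ≡⟨ cong (λ t → + 2 * (+ 2 * + 2ʲ * t)) (χ-pair≡jacobi2 a odd) ⟩
    + 2 * (+ 2 * + 2ʲ * (jacobi2 a * V))
      ≡⟨ cong (+ 2 *_) (commute (+ 2ʲ) (jacobi2 a) V) ⟩
    + 2 * (jacobi2 a * (+ 2 * + 2ʲ * V))
      ≡⟨ cong (+ 2 *_) (jacobi2^K*sqrtA-odd a) ⟨
    + 2 * (jacobi2 a ^ K * sqrtA K i) ∎)
    where
    s = a /ℕ 2
    a≡ = odd⇒a≡1+2s a odd
    collect : ∀ t x y → t * (+ 4 * x) + t * (+ 4 * y) ≡ + 2 * (+ 2 * t * (x + y))
    collect = solve-∀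
    commute : ∀ t J v → + 2 * t * (J * v) ≡ J * (+ 2 * t * v)
    commute = solve-∀

G-one : ∀ a → Odd a → ∀ i → G 1 a i ≡ + 0
G-one a odd i = ℤ.*-cancelˡ-≡ (+ 2) _ _ (begin
  + 2 * G 1 a i              ≡⟨ two-G 0 a odd i ⟩
  gauss 2 a + gauss 2 (- a)  ≡⟨ cong₂ _+_ (gauss-2 s a≡) (gauss-2 (- + 1 - s) (neg-odd s a≡)) ⟩
  + 0                        ∎)
  where
  χ = coord 1 i
  open GaussSums χ (coord-antiperiodic 0 i)
  s = a /ℕ 2
  a≡ = odd⇒a≡1+2s a odd
  gauss-2 : ∀ {c} s → c ≡ + 1 + + 2 * s → gauss 2 c ≡ + 0
  gauss-2 s refl = begin
    χ (c * + 0) + (χ (c * + 1) + + 0)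
      ≡⟨ cong₂ (λ x y → x + (y + + 0)) (cong χ (ℤ.*-zeroʳ c)) (χ-half refl s {w = + 0} (shift s)) ⟩
    χ (+ 0) + (- χ (+ 0) + + 0)
      ≡⟨ cancel (χ (+ 0)) ⟩
    + 0 ∎
    where
    c = + 1 + + 2 * s
    shift : ∀ s → (+ 1 + + 2 * s) * + 1 ≡ + 0 + + 1 + s * (+ 1 + + 1)
    shift = solve-∀
    cancel : ∀ x → x + (- x + + 0) ≡ + 0
    cancel = solve-∀

proposition4p1 : (k : ℕ) (a : ℤ) → 1 ≤ k → Odd a →
    (k ≡ 1 → ∀ i → G k a i ≡ + 0) ×
    (1 < k → ∀ i → G k a i ≡ (jacobi2 a ^ k) * sqrtA k i)
proposition4p1 k a _ odd = (λ { refl → G-one a odd }) , higher k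
  where
  higher : ∀ k → 1 < k → ∀ i → G k a i ≡ jacobi2 a ^ k * sqrtA k i
  higher (suc (suc n)) (s≤s (s≤s _)) with even⊎odd n
  ... | inj₁ (j , refl) = λ i → G-even j i a odd
  ... | inj₂ (j , refl) = λ i → G-odd j i a odd
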